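{- Let $p$ be a pattern of length $\ell$ with orbit size $r$, and let $\mathcal{G}(z)=\sum_{n\ge 0}\mathcal{A}(n)z^n$, $\mathcal{G}_p(z)=\sum_{n\ge0}\mathcal{T}_p(n)z^n$, where $\mathcal{A}(n)$ is the number of words of length $n$ over $\mathcal{A}$ containing no factor in the orbit $p$, and $\mathcal{T}_p(n)$ is the number of words of length $n$ whose only factor in the orbit $p$ occurs at the very end. Then $$\mathcal{G}(z)=\frac{\mathcal{C}^*_{p,p}(z)}{z^\ell+(1-qz)\mathcal{C}^*_{p,p}(z)}=\frac{\mathcal{C}_{p,p}(z)}{rz^\ell+(1-qz)\mathcal{C}_{p,p}(z)},\qquad \mathcal{G}_p(z)=\frac{z^\ell}{z^\ell+(1-qz)\mathcal{C}^*_{p,p}(z)}=\frac{rz^\ell}{rz^\ell+(1-qz)\mathcal{C}_{p,p}(z)}.$$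
   Context: Let $\mathcal{A}$ be a finite alphabet with $q\ge 2$ letters and $G$ a subgroup of the symmetric group on $\mathcal{A}$, acting on words letterwise. Words are equivalent ($\sim$) if they lie in the same $G$-orbit. A pattern is a $G$-orbit of words, represented by its lexicographically least word; substrings $p(i,j)$ of a pattern refer to this representative. $G_w$ is the stabilizer of a word $w$; $G_p$ is the common stabilizer of the words of pattern $p$, and the orbit size of $p$ is $r=|G|/|G_p|$. For a pattern $p$ of length $\ell$, the autocorrelation vector $\mathcal{C}(p,p)=(\mathcal{C}_0,\dots,\mathcal{C}_{\ell-1})$ has $\mathcal{C}_i=|G_x|/|G_p|$ if the suffix $x=p(i+1,\ell)$ is equivalent to the prefix $p(1,\ell-i)$, and $\mathcal{C}_i=0$ otherwise; $\mathcal{C}_{p,p}(z)=\sum_i\mathcal{C}_iz^i$ and $\mathcal{C}^*_{p,p}(z)=\frac1r\mathcal{C}_{p,p}(z)$. -}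

module Defs where

open import Data.Nat as ℕ using (ℕ; zero; suc; _≤ᵇ_; _≡ᵇ_; _∸_; _+_)
open import Data.Nat.Properties as ℕP using ()
open import Data.Fin as F using (Fin)
open import Data.Fin.Properties as FP using ()
open import Data.Vec as V using (Vec; lookup; tabulate)
open import Data.List as L using (List; []; _∷_; length; take; drop; filter; upTo; map; foldr; concatMap)
open import Data.Bool.ListAction using (any)
open import Data.List.Properties as LP using ()
open import Data.List.Membership.Propositional using (_∈_)
open import Data.List.Relation.Unary.Unique.Propositional using (Unique)
open import Data.Bool using (Bool; true; false; _∧_; not; if_then_else_; T)
open import Data.Bool.Properties using (T?)
open import Data.Product using (Σ; _×_; _,_)
open import Data.Sum using (_⊎_)
open import Data.Unit using (⊤)
open import Data.Empty using (⊥)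
open import Data.Integer using (+_)
open import Data.Rational as ℚ using (ℚ; 0ℚ; 1ℚ)
open import Relation.Nullary.Decidable using (⌊_⌋; yes; no)
open import Relation.Binary.PropositionalEquality using (_≡_)

-- Alphabet 𝒜 = Fin q.  A permutation of 𝒜 is stored as its value table.

Perm : ℕ → Set
Perm q = Vec (Fin q) q

idPerm : ∀ {q} → Perm q
idPerm = tabulate (λ i → i)

_∘ₚ_ : ∀ {q} → Perm q → Perm q → Perm q
σ ∘ₚ τ = tabulate (λ i → lookup σ (lookup τ i))

IsPerm : ∀ {q} → Perm q → Set
IsPerm {q} σ = ∀ (i j : Fin q) → lookup σ i ≡ lookup σ j → i ≡ j

record PermGroup (q : ℕ) : Set where
  field
    elems    : List (Perm q)
    unique   : Unique elems
    perms    : ∀ σ → σ ∈ elems → IsPerm σ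
    hasId    : idPerm ∈ elems
    closed   : ∀ σ τ → σ ∈ elems → τ ∈ elems → (σ ∘ₚ τ) ∈ elems
    inverses : ∀ σ → σ ∈ elems → Σ (Perm q) (λ τ → τ ∈ elems × (σ ∘ₚ τ) ≡ idPerm)
open PermGroup public

Word : ℕ → Set
Word q = List (Fin q)

act : ∀ {q} → Perm q → Word q → Word q
act σ w = map (lookup σ) w

_==w_ : ∀ {q} → Word q → Word q → Bool
u ==w v = ⌊ LP.≡-dec F._≟_ u v ⌋

equiv : ∀ {q} → PermGroup q → Word q → Word q → Bool
equiv G u v = any (λ σ → act σ u ==w v) (elems G)

stabSize : ∀ {q} → PermGroup q → Word q → ℕ
stabSize G w = length (filter (λ σ → LP.≡-dec F._≟_ (act σ w) w) (elems G))

_≤lex_ : ∀ {q} → Word q → Word q → Set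
[] ≤lex _ = ⊤
(x ∷ xs) ≤lex [] = ⊥
(x ∷ xs) ≤lex (y ∷ ys) = (x F.< y) ⊎ ((x ≡ y) × (xs ≤lex ys))

IsPattern : ∀ {q} → PermGroup q → Word q → Set
IsPattern G p = ∀ σ → σ ∈ elems G → p ≤lex act σ p

toℚ : ℕ → ℚ
toℚ n = + n ℚ./ 1

-- x / n  (n is always ≥ 1 where used; the value at 0 is irrelevant)
divℚ : ℚ → ℕ → ℚ
divℚ x zero    = 0ℚ
divℚ x (suc n) = x ℚ.* (+ 1 ℚ./ suc n)

-- x / y in ℚ (y ≠ 0 where used; the value at 0 is irrelevant)
divByℚ : ℚ → ℚ → ℚ
divByℚ x y with y ℚ.≟ 0ℚ
... | yes _  = 0ℚ
... | no y≢0 = ℚ._÷_ x y {{ℚ.≢-nonZero y≢0}}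

-- orbit size r = |G| / |G_p|
orbitSize : ∀ {q} → PermGroup q → Word q → ℚ
orbitSize G p = divℚ (toℚ (length (elems G))) (stabSize G p)

Series : Set
Series = ℕ → ℚ

sumℚ : List ℚ → ℚ
sumℚ = foldr ℚ._+_ 0ℚ

_⊕_ : Series → Series → Series
(f ⊕ g) n = f n ℚ.+ g n

_⊖_ : Series → Series → Series
(f ⊖ g) n = f n ℚ.- g n

_⊛_ : Series → Series → Series
(f ⊛ g) n = sumℚ (map (λ k → f k ℚ.* g (n ∸ k)) (upTo (suc n)))

mono : ℚ → ℕ → Series
mono c k n = if k ≡ᵇ n then c else 0ℚ

scale : ℚ → Series → Series
scale c f n = c ℚ.* f n

-- C_i for the pattern p (ℓ = length p); x = p(i+1,ℓ) = drop i p,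
-- prefix p(1,ℓ-i) = take (ℓ ∸ i) p.
autoCoeff : ∀ {q} → PermGroup q → Word q → ℕ → ℚ
autoCoeff G p i =
  if (suc i ≤ᵇ length p) ∧ equiv G (drop i p) (take (length p ∸ i) p)
  then divℚ (toℚ (stabSize G (drop i p))) (stabSize G p)
  else 0ℚ

autoPoly : ∀ {q} → PermGroup q → Word q → Series
autoPoly G p = autoCoeff G p

autoPoly* : ∀ {q} → PermGroup q → Word q → Series
autoPoly* G p i = divByℚ (autoPoly G p i) (orbitSize G p)

allWords : ∀ q → ℕ → List (Word q)
allWords q zero    = [] ∷ []
allWords q (suc n) = concatMap (λ w → map (λ a → a ∷ w) (L.allFin q)) (allWords q n)

-- a factor of w in the orbit of p starts at position i (0-based)
occAt : ∀ {q} → PermGroup q → Word q → Word q → ℕ → Bool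
occAt G p w i = ((i + length p) ≤ᵇ length w) ∧ equiv G (take (length p) (drop i w)) p

avoids : ∀ {q} → PermGroup q → Word q → Word q → Bool
avoids G p w = not (any (occAt G p w) (upTo (suc (length w))))

onlyAtEnd : ∀ {q} → PermGroup q → Word q → Word q → Bool
onlyAtEnd G p w =
  (length p ≤ᵇ length w) ∧ occAt G p w (length w ∸ length p)
    ∧ not (any (occAt G p w) (upTo (length w ∸ length p)))

countA : ∀ {q} → PermGroup q → Word q → ℕ → ℕ
countA {q} G p n = length (filter (λ w → T? (avoids G p w)) (allWords q n))

countT : ∀ {q} → PermGroup q → Word q → ℕ → ℕ
countT {q} G p n = length (filter (λ w → T? (onlyAtEnd G p w)) (allWords q n))

genA : ∀ {q} → PermGroup q → Word q → Series
genA G p n = toℚ (countA G p n)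

genT : ∀ {q} → PermGroup q → Word q → Series
genT G p n = toℚ (countT G p n)

denom* : ∀ {q} → PermGroup q → Word q → Series
denom* {q} G p = mono 1ℚ (length p) ⊕ ((mono 1ℚ 0 ⊖ mono (toℚ q) 1) ⊛ autoPoly* G p)

denom : ∀ {q} → PermGroup q → Word q → Series
denom {q} G p = mono (orbitSize G p) (length p) ⊕ ((mono 1ℚ 0 ⊖ mono (toℚ q) 1) ⊛ autoPoly G p)

-- Appending a letter to a word of length n that avoids the orbit of p yields a word
-- that either still avoids it or has its only occurrence at the very end, so
-- 𝒜(n+1) + 𝒯(n+1) = q 𝒜(n), i.e. 𝒢_p(z) + (1 - qz) 𝒢(z) = 1.
-- Appending σ(p) (σ ∈ G) to an avoiding word w of length n creates an occurrence;
-- cutting w σ(p) just after its first occurrence, which ends i < ℓ letters before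
-- the end, leaves a word u counted by 𝒯(n+ℓ-i).  Conversely, u ends with some τ(p),
-- so σ(p(1,ℓ-i)) = τ(p(i+1,ℓ)) and u arises from exactly |G_x| elements σ if the
-- suffix x = p(i+1,ℓ) is equivalent to the prefix p(1,ℓ-i), and from none otherwise.
-- Counting the pairs (σ, w) gives |G| 𝒜(n) = Σ_i |G_p| 𝒞_i 𝒯(n+ℓ-i), that is
-- 𝒞(z) 𝒢_p(z) = r z^ℓ 𝒢(z).  Solving the two identities gives both formulas, and
-- dividing numerator and denominator by r gives the starred ones.

module Submission where

open import Defs
open import Algebra.Bundles using (CommutativeSemiring; CommutativeRing)
open import Data.Bool using (Bool; true; false; _∧_; _∨_; not; if_then_else_; T)
open import Data.Bool.ListAction using (any)
import Data.Bool.Properties as BoolP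
open import Data.Bool.Properties using (T?; T-∧; T-≡; ¬-not)
open import Data.Empty using (⊥-elim)
open import Data.Fin as F using (Fin)
import Data.Integer as ℤ
import Data.Integer.Properties as ℤP
open import Data.List as L using (List; []; _∷_; _++_; map; foldr; concatMap; length; filter; take; drop; upTo; applyUpTo; allFin)
import Data.List.Properties as LP
open import Data.List.Membership.Propositional using (_∈_; find; lose)
open import Data.List.Membership.Propositional.Properties using (∈-map⁺; ∈-map⁻; ∈-upTo⁻)
open import Data.List.Membership.Propositional.Properties.WithK using (unique∧set⇒bag)
open import Data.List.Relation.Binary.BagAndSetEquality using (∼bag⇒↭)
open import Data.List.Relation.Binary.Permutation.Propositional as ↭ using (_↭_)
open import Data.List.Relation.Unary.Any using (here; there)
open import Data.List.Relation.Unary.Any.Properties using (any⁺; any⁻)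
import Data.List.Relation.Unary.Unique.Propositional.Properties as Unique
open import Data.Nat as ℕ using (ℕ; zero; suc; _∸_; _≤_; _<_; z≤n; s≤s; _≡ᵇ_; _≤ᵇ_)
import Data.Nat.Coprimality as Coprimality
import Data.Nat.Properties as ℕP
open import Data.Product using (∃; _×_; _,_; proj₁; proj₂; uncurry)
open import Data.Rational as ℚ using (ℚ; 0ℚ; 1ℚ; Positive)
import Data.Rational.Properties as ℚP
open import Data.Rational.Solver using (module +-*-Solver)
import Data.Rational.Unnormalised as ℚᵘ
import Data.Rational.Unnormalised.Properties as ℚᵘP
open import Data.Sum using (inj₁; inj₂; [_,_]′)
open import Data.Unit using (tt)
open import Data.Vec using (lookup)
import Data.Vec.Properties as VP
open import Function using (_∘_; id; mk⇔)
open import Function.Bundles using (module Equivalence)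
open import Relation.Binary.PropositionalEquality using (_≡_; _≢_; refl; sym; trans; cong; cong₂; subst; ≢-sym; module ≡-Reasoning)
open import Relation.Nullary.Decidable using (⌊_⌋; Dec; yes; no; toWitness; map′; _×-dec_)
open import Relation.Unary using (Decidable)

-- Finite sums and boolean tests

module ListSum {c ℓ} (S : CommutativeSemiring c ℓ) where

  open CommutativeSemiring S renaming (refl to ≈-refl; sym to ≈-sym; trans to ≈-trans)
  open import Algebra.Properties.CommutativeSemigroup +-commutativeSemigroup
    using (interchange; x∙yz≈y∙xz)
  open import Relation.Binary.Reasoning.Setoid setoid

  private variable
    A B : Set
    f g : A → Carrier

  ∑ : (A → Carrier) → List A → Carrier
  ∑ f xs = foldr _+_ 0# (map f xs)

  ∑-cong-∈ : ∀ xs → (∀ {x} → x ∈ xs → f x ≈ g x) → ∑ f xs ≈ ∑ g xs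
  ∑-cong-∈ []       e = ≈-refl
  ∑-cong-∈ (x ∷ xs) e = +-cong (e (here refl)) (∑-cong-∈ xs (e ∘ there))

  ∑-cong : (∀ x → f x ≈ g x) → ∀ xs → ∑ f xs ≈ ∑ g xs
  ∑-cong e xs = ∑-cong-∈ xs (λ {x} _ → e x)

  ∑-zero-∈ : ∀ xs → (∀ {x} → x ∈ xs → f x ≈ 0#) → ∑ f xs ≈ 0#
  ∑-zero-∈ []       e = ≈-refl
  ∑-zero-∈ (x ∷ xs) e = ≈-trans (+-cong (e (here refl)) (∑-zero-∈ xs (e ∘ there))) (+-identityˡ 0#)

  ∑-++ : ∀ (f : A → Carrier) xs ys → ∑ f (xs ++ ys) ≈ ∑ f xs + ∑ f ys
  ∑-++ f []       ys = ≈-sym (+-identityˡ _)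
  ∑-++ f (x ∷ xs) ys = ≈-trans (+-congˡ (∑-++ f xs ys)) (≈-sym (+-assoc (f x) _ _))

  ∑-map : ∀ (f : B → Carrier) (g : A → B) xs → ∑ f (map g xs) ≈ ∑ (f ∘ g) xs
  ∑-map f g []       = ≈-refl
  ∑-map f g (x ∷ xs) = +-congˡ (∑-map f g xs)

  ∑-concatMap : ∀ (f : B → Carrier) (g : A → List B) xs →
                ∑ f (concatMap g xs) ≈ ∑ (λ x → ∑ f (g x)) xs
  ∑-concatMap f g []       = ≈-refl
  ∑-concatMap f g (x ∷ xs) = ≈-trans (∑-++ f (g x) (concatMap g xs)) (+-congˡ (∑-concatMap f g xs))

  ∑-distrib-+ : ∀ (f g : A → Carrier) xs → ∑ (λ x → f x + g x) xs ≈ ∑ f xs + ∑ g xs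
  ∑-distrib-+ f g []       = ≈-sym (+-identityˡ 0#)
  ∑-distrib-+ f g (x ∷ xs) =
    ≈-trans (+-congˡ (∑-distrib-+ f g xs)) (interchange (f x) (g x) (∑ f xs) (∑ g xs))

  ∑-*ˡ : ∀ k (f : A → Carrier) xs → ∑ (λ x → k * f x) xs ≈ k * ∑ f xs
  ∑-*ˡ k f []       = ≈-sym (zeroʳ k)
  ∑-*ˡ k f (x ∷ xs) = ≈-trans (+-congˡ (∑-*ˡ k f xs)) (≈-sym (distribˡ k (f x) (∑ f xs)))

  ∑-swap : ∀ (f : A → B → Carrier) xs ys →
           ∑ (λ x → ∑ (f x) ys) xs ≈ ∑ (λ y → ∑ (λ x → f x y) xs) ys
  ∑-swap f []       ys = ≈-sym (∑-zero-∈ ys (λ _ → ≈-refl))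
  ∑-swap f (x ∷ xs) ys =
    ≈-trans (+-congˡ (∑-swap f xs ys)) (≈-sym (∑-distrib-+ (f x) (λ y → ∑ (λ x → f x y) xs) ys))

  ∑-↭ : ∀ (f : A → Carrier) {xs ys} → xs ↭ ys → ∑ f xs ≈ ∑ f ys
  ∑-↭ f ↭.refl                  = ≈-refl
  ∑-↭ f (↭.prep x xs↭ys)         = +-congˡ (∑-↭ f xs↭ys)
  ∑-↭ f (↭.swap x y xs↭ys)       = ≈-trans (x∙yz≈y∙xz (f x) (f y) _) (+-congˡ (+-congˡ (∑-↭ f xs↭ys)))
  ∑-↭ f (↭.trans xs↭ys ys↭zs)    = ≈-trans (∑-↭ f xs↭ys) (∑-↭ f ys↭zs)

  ∑< : (ℕ → Carrier) → ℕ → Carrier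
  ∑< f m = ∑ f (upTo m)

  ∑<-cong : ∀ m → (∀ k → k < m → f k ≈ g k) → ∑< f m ≈ ∑< g m
  ∑<-cong m e = ∑-cong-∈ (upTo m) (λ k∈ → e _ (∈-upTo⁻ k∈))

  ∑<-zero : ∀ m → (∀ k → k < m → f k ≈ 0#) → ∑< f m ≈ 0#
  ∑<-zero m e = ∑-zero-∈ (upTo m) (λ k∈ → e _ (∈-upTo⁻ k∈))

  ∑<-suc : ∀ f m → ∑< f (suc m) ≈ ∑< f m + f m
  ∑<-suc f m = begin
    ∑ f (upTo (suc m))           ≡⟨ cong (∑ f) (sym (LP.upTo-∷ʳ m)) ⟩
    ∑ f (upTo m ++ m ∷ [])       ≈⟨ ∑-++ f (upTo m) (m ∷ []) ⟩
    ∑< f m + (f m + 0#)          ≈⟨ +-congˡ (+-identityʳ (f m)) ⟩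
    ∑< f m + f m                 ∎

  ∑<-head : ∀ f m → ∑< f (suc m) ≈ f 0 + ∑< (f ∘ suc) m
  ∑<-head f m = +-congˡ (begin
    ∑ f (applyUpTo suc m)       ≡⟨ cong (∑ f) (sym (LP.map-applyUpTo id suc m)) ⟩
    ∑ f (map suc (upTo m))      ≈⟨ ∑-map f suc (upTo m) ⟩
    ∑< (f ∘ suc) m              ∎)

  ∑<-+ : ∀ f a b → ∑< f (a ℕ.+ b) ≈ ∑< f a + ∑< (λ j → f (a ℕ.+ j)) b
  ∑<-+ f a zero    = subst (λ n → ∑< f n ≈ ∑< f a + 0#) (sym (ℕP.+-identityʳ a)) (≈-sym (+-identityʳ _))
  ∑<-+ f a (suc b) = begin
    ∑< f (a ℕ.+ suc b)                        ≡⟨ cong (∑< f) (ℕP.+-suc a b) ⟩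
    ∑< f (suc (a ℕ.+ b))                      ≈⟨ ∑<-suc f (a ℕ.+ b) ⟩
    ∑< f (a ℕ.+ b) + f (a ℕ.+ b)              ≈⟨ +-congʳ (∑<-+ f a b) ⟩
    (∑< f a + ∑< f′ b) + f′ b                 ≈⟨ +-assoc _ _ _ ⟩
    ∑< f a + (∑< f′ b + f′ b)                 ≈⟨ +-congˡ (≈-sym (∑<-suc f′ b)) ⟩
    ∑< f a + ∑< f′ (suc b)                    ∎
    where
      f′ : ℕ → Carrier
      f′ j = f (a ℕ.+ j)

  ∑<-reverse : ∀ f m → ∑< f (suc m) ≈ ∑< (λ i → f (m ∸ i)) (suc m)
  ∑<-reverse f zero    = ≈-refl
  ∑<-reverse f (suc m) = begin
    ∑< f (suc (suc m))                            ≈⟨ ∑<-head f (suc m) ⟩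
    f 0 + ∑< (f ∘ suc) (suc m)                    ≈⟨ +-congˡ (∑<-reverse (f ∘ suc) m) ⟩
    f 0 + ∑< (λ i → f (suc (m ∸ i))) (suc m)      ≈⟨ +-comm _ _ ⟩
    ∑< (λ i → f (suc (m ∸ i))) (suc m) + f 0      ≈⟨ +-congʳ (∑<-cong (suc m) (λ i i<1+m → reflexive
                                                       (cong f (sym (ℕP.+-∸-assoc 1 (ℕP.≤-pred i<1+m)))))) ⟩
    ∑< f′ (suc m) + f 0                           ≡⟨ cong (λ k → ∑< f′ (suc m) + f k) (sym (ℕP.n∸n≡0 (suc m))) ⟩
    ∑< f′ (suc m) + f′ (suc m)                    ≈⟨ ≈-sym (∑<-suc f′ (suc m)) ⟩
    ∑< f′ (suc (suc m))                           ∎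
    where
      f′ : ℕ → Carrier
      f′ i = f (suc m ∸ i)

-- Imported only here: inside ListSum, _+_ and _*_ are the semiring operations.
open import Data.Nat using (_+_; _*_)

module ℕΣ = ListSum ℕP.+-*-commutativeSemiring
module ℚΣ = ListSum (CommutativeRing.commutativeSemiring ℚP.+-*-commutativeRing)

𝟙 : Bool → ℕ
𝟙 true  = 1
𝟙 false = 0

𝟙-∧ : ∀ a b → 𝟙 (a ∧ b) ≡ 𝟙 a * 𝟙 b
𝟙-∧ true  b = sym (ℕP.+-identityʳ (𝟙 b))
𝟙-∧ false b = refl

⌊T?⌋ : ∀ b → ⌊ T? b ⌋ ≡ b
⌊T?⌋ true  = refl
⌊T?⌋ false = refl

length-filter-∑ : ∀ {A : Set} {P : A → Set} (P? : Decidable P) xs →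
                  length (filter P? xs) ≡ ℕΣ.∑ (𝟙 ∘ ⌊_⌋ ∘ P?) xs
length-filter-∑ P? []       = refl
length-filter-∑ P? (x ∷ xs) with P? x
... | yes _ = cong suc (length-filter-∑ P? xs)
... | no  _ = length-filter-∑ P? xs

∑-const : ∀ {A : Set} c (xs : List A) → ℕΣ.∑ (λ _ → c) xs ≡ length xs * c
∑-const c []       = refl
∑-const c (x ∷ xs) = cong (c +_) (∑-const c xs)

∈⇒≤∑ : ∀ {A : Set} (f : A → ℕ) {x xs} → x ∈ xs → f x ≤ ℕΣ.∑ f xs
∈⇒≤∑ f {x}          (here refl) = ℕP.m≤m+n (f x) _
∈⇒≤∑ f {xs = y ∷ _} (there x∈)  = ℕP.≤-trans (∈⇒≤∑ f x∈) (ℕP.m≤n+m _ (f y))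

≡ᵇ-true : ∀ {m n} → m ≡ n → (m ≡ᵇ n) ≡ true
≡ᵇ-true {m} {n} m≡n = Equivalence.to T-≡ (ℕP.≡⇒≡ᵇ m n m≡n)

≡ᵇ-false : ∀ {m n} → m ≢ n → (m ≡ᵇ n) ≡ false
≡ᵇ-false {m} {n} m≢n = ¬-not (λ e → m≢n (ℕP.≡ᵇ⇒≡ m n (Equivalence.from T-≡ e)))

≤ᵇ-true : ∀ {m n} → m ≤ n → (m ≤ᵇ n) ≡ true
≤ᵇ-true m≤n = Equivalence.to T-≡ (ℕP.≤⇒≤ᵇ m≤n)

≤ᵇ-false : ∀ {m n} → n < m → (m ≤ᵇ n) ≡ false
≤ᵇ-false {m} {n} n<m = ¬-not (λ e → ℕP.<⇒≱ n<m (ℕP.≤ᵇ⇒≤ m n (Equivalence.from T-≡ e)))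

-- Rational numbers and power series

toℚᵘ-toℚ : ∀ n → ℚ.toℚᵘ (toℚ n) ≡ ℚᵘ.mkℚᵘ (ℤ.+ n) 0
toℚᵘ-toℚ n = cong ℚ.toℚᵘ (ℚP.normalize-coprime (Coprimality.sym (Coprimality.1-coprimeTo n)))

toℚ-+ : ∀ m n → toℚ (m + n) ≡ toℚ m ℚ.+ toℚ n
toℚ-+ m n = ℚP.toℚᵘ-injective (begin-equality
  ℚ.toℚᵘ (toℚ (m + n))                  ≡⟨ toℚᵘ-toℚ (m + n) ⟩
  ℚᵘ.mkℚᵘ (ℤ.+ (m + n)) 0               ≃⟨ ℚᵘ.*≡* (cong (ℤ._* ℤ.+ 1) numerators) ⟩
  ℚᵘ.mkℚᵘ (ℤ.+ m) 0 ℚᵘ.+ ℚᵘ.mkℚᵘ (ℤ.+ n) 0 ≡⟨ sym (cong₂ ℚᵘ._+_ (toℚᵘ-toℚ m) (toℚᵘ-toℚ n)) ⟩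
  ℚ.toℚᵘ (toℚ m) ℚᵘ.+ ℚ.toℚᵘ (toℚ n)      ≃⟨ ℚP.toℚᵘ-homo-+ (toℚ m) (toℚ n) ⟨
  ℚ.toℚᵘ (toℚ m ℚ.+ toℚ n)                ∎)
  where
    open ℚᵘP.≤-Reasoning
    numerators : ℤ.+ (m + n) ≡ ℤ.+ m ℤ.* ℤ.+ 1 ℤ.+ ℤ.+ n ℤ.* ℤ.+ 1
    numerators = trans (ℤP.pos-+ m n) (sym (cong₂ ℤ._+_ (ℤP.*-identityʳ (ℤ.+ m)) (ℤP.*-identityʳ (ℤ.+ n))))

toℚ-* : ∀ m n → toℚ (m * n) ≡ toℚ m ℚ.* toℚ n
toℚ-* m n = ℚP.toℚᵘ-injective (begin-equality
  ℚ.toℚᵘ (toℚ (m * n))                  ≡⟨ toℚᵘ-toℚ (m * n) ⟩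
  ℚᵘ.mkℚᵘ (ℤ.+ (m * n)) 0               ≃⟨ ℚᵘ.*≡* (cong (ℤ._* ℤ.+ 1) (ℤP.pos-* m n)) ⟩
  ℚᵘ.mkℚᵘ (ℤ.+ m) 0 ℚᵘ.* ℚᵘ.mkℚᵘ (ℤ.+ n) 0 ≡⟨ sym (cong₂ ℚᵘ._*_ (toℚᵘ-toℚ m) (toℚᵘ-toℚ n)) ⟩
  ℚ.toℚᵘ (toℚ m) ℚᵘ.* ℚ.toℚᵘ (toℚ n)      ≃⟨ ℚP.toℚᵘ-homo-* (toℚ m) (toℚ n) ⟨
  ℚ.toℚᵘ (toℚ m ℚ.* toℚ n)                ∎)
  where open ℚᵘP.≤-Reasoning

toℚ-∑ : ∀ {A : Set} (f : A → ℕ) xs → toℚ (ℕΣ.∑ f xs) ≡ ℚΣ.∑ (toℚ ∘ f) xs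
toℚ-∑ f []       = refl
toℚ-∑ f (x ∷ xs) = trans (toℚ-+ (f x) _) (cong (toℚ (f x) ℚ.+_) (toℚ-∑ f xs))

divℚ-≡-*-divℚ1 : ∀ x k → divℚ x k ≡ x ℚ.* divℚ 1ℚ k
divℚ-≡-*-divℚ1 x zero    = sym (ℚP.*-zeroʳ x)
divℚ-≡-*-divℚ1 x (suc k) = cong (x ℚ.*_) (sym (ℚP.*-identityˡ _))

divℚ-suc-≢0 : ∀ m k → divℚ (toℚ (suc m)) (suc k) ≢ 0ℚ
divℚ-suc-≢0 m k = ≢-sym (ℚP.<⇒≢ (ℚP.positive⁻¹ _ {{positive}}))
  where
    instance
      pos-m : Positive (toℚ (suc m))
      pos-m = ℚP.normalize-pos (suc m) 1
      pos-k : Positive (ℤ.+ 1 ℚ./ suc k)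
      pos-k = ℚP.normalize-pos 1 (suc k)
    positive : Positive (divℚ (toℚ (suc m)) (suc k))
    positive = ℚP.pos*pos⇒pos (toℚ (suc m)) (ℤ.+ 1 ℚ./ suc k)

divByℚ-≡-*-divByℚ1 : ∀ x y → divByℚ x y ≡ x ℚ.* divByℚ 1ℚ y
divByℚ-≡-*-divByℚ1 x y with y ℚ.≟ 0ℚ
... | yes _ = sym (ℚP.*-zeroʳ x)
... | no  _ = cong (x ℚ.*_) (sym (ℚP.*-identityˡ _))

*-divByℚ1-inverse : ∀ y → y ≢ 0ℚ → y ℚ.* divByℚ 1ℚ y ≡ 1ℚ
*-divByℚ1-inverse y y≢0 with y ℚ.≟ 0ℚ
... | yes y≡0 = ⊥-elim (y≢0 y≡0)
... | no  y≢0 = trans (cong (y ℚ.*_) (ℚP.*-identityˡ _)) (ℚP.*-inverseʳ y {{ℚ.≢-nonZero y≢0}})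

shift : Series → Series
shift f zero    = 0ℚ
shift f (suc n) = f n

-- Multiplication by 1 - cz, kept pointwise so that the identities below never need
-- associativity of ⊛.
mulOneMinus : ℚ → Series → Series
mulOneMinus c f = f ⊕ scale (ℚ.- c) (shift f)

mulOneMinus-cong : ∀ c {f g} → (∀ n → f n ≡ g n) → ∀ n → mulOneMinus c f n ≡ mulOneMinus c g n
mulOneMinus-cong c f≗g zero    = cong (ℚ._+ ℚ.- c ℚ.* 0ℚ) (f≗g 0)
mulOneMinus-cong c f≗g (suc n) = cong₂ (λ x y → x ℚ.+ ℚ.- c ℚ.* y) (f≗g (suc n)) (f≗g n)

⊛-congʳ : ∀ f {g g′} → (∀ n → g n ≡ g′ n) → ∀ n → (f ⊛ g) n ≡ (f ⊛ g′) n
⊛-congʳ f g≗g′ n = ℚΣ.∑<-cong (suc n) (λ k _ → cong (f k ℚ.*_) (g≗g′ (n ∸ k)))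

⊛-comm : ∀ f g n → (f ⊛ g) n ≡ (g ⊛ f) n
⊛-comm f g n = trans (ℚΣ.∑<-reverse (λ k → f k ℚ.* g (n ∸ k)) n) (ℚΣ.∑<-cong (suc n) reindex)
  where
    reindex : ∀ k → k < suc n → f (n ∸ k) ℚ.* g (n ∸ (n ∸ k)) ≡ g k ℚ.* f (n ∸ k)
    reindex k (s≤s k≤n) = trans (cong (λ j → f (n ∸ k) ℚ.* g j) (ℕP.m∸[m∸n]≡n k≤n)) (ℚP.*-comm (f (n ∸ k)) (g k))

⊛-distribˡ-⊕ : ∀ f g h n → (f ⊛ (g ⊕ h)) n ≡ (f ⊛ g) n ℚ.+ (f ⊛ h) n
⊛-distribˡ-⊕ f g h n = trans (ℚΣ.∑<-cong (suc n) (λ k _ → ℚP.*-distribˡ-+ (f k) (g (n ∸ k)) (h (n ∸ k))))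
  (ℚΣ.∑-distrib-+ (λ k → f k ℚ.* g (n ∸ k)) (λ k → f k ℚ.* h (n ∸ k)) (upTo (suc n)))

⊛-scaleʳ : ∀ c f g n → (f ⊛ scale c g) n ≡ c ℚ.* (f ⊛ g) n
⊛-scaleʳ c f g n = trans (ℚΣ.∑<-cong (suc n) (λ k _ → x[cy]≡c[xy] (f k) c (g (n ∸ k))))
  (ℚΣ.∑-*ˡ c (λ k → f k ℚ.* g (n ∸ k)) (upTo (suc n)))
  where
    open +-*-Solver
    x[cy]≡c[xy] : ∀ x c y → x ℚ.* (c ℚ.* y) ≡ c ℚ.* (x ℚ.* y)
    x[cy]≡c[xy] = solve 3 (λ x c y → x :* (c :* y) := c :* (x :* y)) refl

⊛-shiftʳ : ∀ f g n → (f ⊛ shift g) n ≡ shift (f ⊛ g) n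
⊛-shiftʳ f g zero    = trans (ℚP.+-identityʳ _) (ℚP.*-zeroʳ (f 0))
⊛-shiftʳ f g (suc n) = begin
  ℚΣ.∑< (λ k → f k ℚ.* shift g (suc n ∸ k)) (suc (suc n))
    ≡⟨ ℚΣ.∑<-suc (λ k → f k ℚ.* shift g (suc n ∸ k)) (suc n) ⟩
  ℚΣ.∑< (λ k → f k ℚ.* shift g (suc n ∸ k)) (suc n) ℚ.+ f (suc n) ℚ.* shift g (suc n ∸ suc n)
    ≡⟨ cong₂ ℚ._+_ (ℚΣ.∑<-cong (suc n) unshift) (trans (cong (λ j → f (suc n) ℚ.* shift g j) (ℕP.n∸n≡0 n)) (ℚP.*-zeroʳ (f (suc n)))) ⟩
  (f ⊛ g) n ℚ.+ 0ℚ
    ≡⟨ ℚP.+-identityʳ _ ⟩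
  (f ⊛ g) n ∎
  where
    open ≡-Reasoning
    unshift : ∀ k → k < suc n → f k ℚ.* shift g (suc n ∸ k) ≡ f k ℚ.* g (n ∸ k)
    unshift k (s≤s k≤n) = cong (λ j → f k ℚ.* shift g j) (ℕP.+-∸-assoc 1 k≤n)

⊛-mulOneMinusʳ : ∀ c f g n → (f ⊛ mulOneMinus c g) n ≡ mulOneMinus c (f ⊛ g) n
⊛-mulOneMinusʳ c f g n = begin
  (f ⊛ mulOneMinus c g) n                                  ≡⟨ ⊛-distribˡ-⊕ f g (scale (ℚ.- c) (shift g)) n ⟩
  (f ⊛ g) n ℚ.+ (f ⊛ scale (ℚ.- c) (shift g)) n            ≡⟨ cong ((f ⊛ g) n ℚ.+_) (⊛-scaleʳ (ℚ.- c) f (shift g) n) ⟩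
  (f ⊛ g) n ℚ.+ ℚ.- c ℚ.* (f ⊛ shift g) n                  ≡⟨ cong (λ x → (f ⊛ g) n ℚ.+ ℚ.- c ℚ.* x) (⊛-shiftʳ f g n) ⟩
  mulOneMinus c (f ⊛ g) n                                  ∎
  where open ≡-Reasoning

mono-≢ : ∀ c {k n} → k ≢ n → mono c k n ≡ 0ℚ
mono-≢ c k≢n rewrite ≡ᵇ-false k≢n = refl

mono-≡ : ∀ c k → mono c k k ≡ c
mono-≡ c k rewrite ≡ᵇ-true (refl {x = k}) = refl

*-mono : ∀ a c k n → a ℚ.* mono c k n ≡ mono (a ℚ.* c) k n
*-mono a c k n with k ≡ᵇ n
... | true  = refl
... | false = ℚP.*-zeroʳ a

∑<-mono-≤ : ∀ c ℓ (g : Series) m → m ≤ ℓ → ℚΣ.∑< (λ k → mono c ℓ k ℚ.* g k) m ≡ 0ℚ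
∑<-mono-≤ c ℓ g m m≤ℓ = ℚΣ.∑<-zero m (λ k k<m →
  trans (cong (ℚ._* g k) (mono-≢ c (ℕP.>⇒≢ (ℕP.<-≤-trans k<m m≤ℓ)))) (ℚP.*-zeroˡ (g k)))

∑<-mono-> : ∀ c ℓ (g : Series) m → ℓ < m → ℚΣ.∑< (λ k → mono c ℓ k ℚ.* g k) m ≡ c ℚ.* g ℓ
∑<-mono-> c ℓ g (suc m) (s≤s ℓ≤m) with ℕP.m≤n⇒m<n∨m≡n ℓ≤m
... | inj₁ ℓ<m = begin
  ℚΣ.∑< h (suc m)                    ≡⟨ ℚΣ.∑<-suc h m ⟩
  ℚΣ.∑< h m ℚ.+ mono c ℓ m ℚ.* g m   ≡⟨ cong₂ ℚ._+_ (∑<-mono-> c ℓ g m ℓ<m) (cong (ℚ._* g m) (mono-≢ c (ℕP.<⇒≢ ℓ<m))) ⟩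
  c ℚ.* g ℓ ℚ.+ 0ℚ ℚ.* g m        ≡⟨ cong (c ℚ.* g ℓ ℚ.+_) (ℚP.*-zeroˡ (g m)) ⟩
  c ℚ.* g ℓ ℚ.+ 0ℚ                ≡⟨ ℚP.+-identityʳ _ ⟩
  c ℚ.* g ℓ                       ∎
  where open ≡-Reasoning
        h : ℕ → ℚ
        h k = mono c ℓ k ℚ.* g k
... | inj₂ refl = begin
  ℚΣ.∑< h (suc ℓ)                    ≡⟨ ℚΣ.∑<-suc h ℓ ⟩
  ℚΣ.∑< h ℓ ℚ.+ mono c ℓ ℓ ℚ.* g ℓ   ≡⟨ cong₂ ℚ._+_ (∑<-mono-≤ c ℓ g ℓ ℕP.≤-refl) (cong (ℚ._* g ℓ) (mono-≡ c ℓ)) ⟩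
  0ℚ ℚ.+ c ℚ.* g ℓ                ≡⟨ ℚP.+-identityˡ _ ⟩
  c ℚ.* g ℓ                       ∎
  where open ≡-Reasoning
        h : ℕ → ℚ
        h k = mono c ℓ k ℚ.* g k

⊛-mono : ∀ f c ℓ n → ℓ ≤ n → (f ⊛ mono c ℓ) n ≡ c ℚ.* f (n ∸ ℓ)
⊛-mono f c ℓ n ℓ≤n = trans (⊛-comm f (mono c ℓ) n) (∑<-mono-> c ℓ (λ k → f (n ∸ k)) (suc n) (s≤s ℓ≤n))

⊛-mono-< : ∀ f c ℓ n → n < ℓ → (f ⊛ mono c ℓ) n ≡ 0ℚ
⊛-mono-< f c ℓ n n<ℓ = trans (⊛-comm f (mono c ℓ) n) (∑<-mono-≤ c ℓ (λ k → f (n ∸ k)) (suc n) n<ℓ)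

oneMinus-⊛ : ∀ c g n → ((mono 1ℚ 0 ⊖ mono c 1) ⊛ g) n ≡ mulOneMinus c g n
oneMinus-⊛ c g n = begin
  ((mono 1ℚ 0 ⊖ mono c 1) ⊛ g) n                       ≡⟨ ⊛-comm (mono 1ℚ 0 ⊖ mono c 1) g n ⟩
  (g ⊛ (mono 1ℚ 0 ⊖ mono c 1)) n                       ≡⟨ ⊛-congʳ g as-sum n ⟩
  (g ⊛ (mono 1ℚ 0 ⊕ mono (ℚ.- c) 1)) n                 ≡⟨ ⊛-distribˡ-⊕ g (mono 1ℚ 0) (mono (ℚ.- c) 1) n ⟩
  (g ⊛ mono 1ℚ 0) n ℚ.+ (g ⊛ mono (ℚ.- c) 1) n         ≡⟨ cong₂ ℚ._+_ (trans (⊛-mono g 1ℚ 0 n z≤n) (ℚP.*-identityˡ (g n))) (linear-term n) ⟩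
  mulOneMinus c g n                                    ∎
  where
    open ≡-Reasoning
    as-sum : ∀ j → (mono 1ℚ 0 ⊖ mono c 1) j ≡ (mono 1ℚ 0 ⊕ mono (ℚ.- c) 1) j
    as-sum zero          = refl
    as-sum (suc zero)    = refl
    as-sum (suc (suc j)) = refl
    linear-term : ∀ n → (g ⊛ mono (ℚ.- c) 1) n ≡ ℚ.- c ℚ.* shift g n
    linear-term zero    = trans (⊛-mono-< g (ℚ.- c) 1 0 (s≤s z≤n)) (sym (ℚP.*-zeroʳ (ℚ.- c)))
    linear-term (suc n) = ⊛-mono g (ℚ.- c) 1 (suc n) (s≤s z≤n)

⊛-truncateˡ : ∀ f g ℓ n → (∀ i → ℓ ≤ i → f i ≡ 0ℚ) → ℓ ≤ n → (f ⊛ g) n ≡ ℚΣ.∑< (λ i → f i ℚ.* g (n ∸ i)) ℓ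
⊛-truncateˡ f g ℓ n f-vanishes ℓ≤n = begin
  ℚΣ.∑< h (suc n)                                   ≡⟨ cong (ℚΣ.∑< h) ℓ+[1+n∸ℓ]≡1+n ⟨
  ℚΣ.∑< h (ℓ + (suc n ∸ ℓ))                        ≡⟨ ℚΣ.∑<-+ h ℓ (suc n ∸ ℓ) ⟩
  ℚΣ.∑< h ℓ ℚ.+ ℚΣ.∑< (λ j → h (ℓ + j)) (suc n ∸ ℓ)   ≡⟨ cong (ℚΣ.∑< h ℓ ℚ.+_) (ℚΣ.∑<-zero (suc n ∸ ℓ) (λ j _ → tail-vanishes j)) ⟩
  ℚΣ.∑< h ℓ ℚ.+ 0ℚ                                  ≡⟨ ℚP.+-identityʳ _ ⟩
  ℚΣ.∑< h ℓ                                         ∎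
  where
    open ≡-Reasoning
    h : ℕ → ℚ
    h i = f i ℚ.* g (n ∸ i)
    ℓ+[1+n∸ℓ]≡1+n : ℓ + (suc n ∸ ℓ) ≡ suc n
    ℓ+[1+n∸ℓ]≡1+n = ℕP.m+[n∸m]≡n (ℕP.m≤n⇒m≤1+n ℓ≤n)
    tail-vanishes : ∀ j → h (ℓ + j) ≡ 0ℚ
    tail-vanishes j = trans (cong (ℚ._* g (n ∸ (ℓ + j))) (f-vanishes (ℓ + j) (ℕP.m≤m+n ℓ j))) (ℚP.*-zeroˡ (g (n ∸ (ℓ + j))))

module FromRecurrences (A T C : Series) (c r : ℚ) (ℓ : ℕ)
  (firstRecurrence  : ∀ n → T n ℚ.+ mulOneMinus c A n ≡ mono 1ℚ 0 n)
  (secondRecurrence : ∀ n → (C ⊛ T) n ≡ (A ⊛ mono r ℓ) n)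
  where

  open ≡-Reasoning

  denominator : Series
  denominator = mono r ℓ ⊕ ((mono 1ℚ 0 ⊖ mono c 1) ⊛ C)

  ⊛-denominator : ∀ f n → (f ⊛ denominator) n ≡ (f ⊛ mono r ℓ) n ℚ.+ mulOneMinus c (f ⊛ C) n
  ⊛-denominator f n = begin
    (f ⊛ denominator) n                                           ≡⟨ ⊛-distribˡ-⊕ f (mono r ℓ) ((mono 1ℚ 0 ⊖ mono c 1) ⊛ C) n ⟩
    (f ⊛ mono r ℓ) n ℚ.+ (f ⊛ ((mono 1ℚ 0 ⊖ mono c 1) ⊛ C)) n     ≡⟨ cong ((f ⊛ mono r ℓ) n ℚ.+_) (⊛-congʳ f (oneMinus-⊛ c C) n) ⟩
    (f ⊛ mono r ℓ) n ℚ.+ (f ⊛ mulOneMinus c C) n                  ≡⟨ cong ((f ⊛ mono r ℓ) n ℚ.+_) (⊛-mulOneMinusʳ c f C n) ⟩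
    (f ⊛ mono r ℓ) n ℚ.+ mulOneMinus c (f ⊛ C) n                  ∎

  T⊛+A⊛-cancel : ∀ g n → (T ⊛ g) n ℚ.+ mulOneMinus c (A ⊛ g) n ≡ g n
  T⊛+A⊛-cancel g n = begin
    (T ⊛ g) n ℚ.+ mulOneMinus c (A ⊛ g) n    ≡⟨ cong₂ ℚ._+_ (⊛-comm T g n) (mulOneMinus-cong c (⊛-comm A g) n) ⟩
    (g ⊛ T) n ℚ.+ mulOneMinus c (g ⊛ A) n    ≡⟨ cong ((g ⊛ T) n ℚ.+_) (⊛-mulOneMinusʳ c g A n) ⟨
    (g ⊛ T) n ℚ.+ (g ⊛ mulOneMinus c A) n    ≡⟨ ⊛-distribˡ-⊕ g T (mulOneMinus c A) n ⟨
    (g ⊛ (T ⊕ mulOneMinus c A)) n            ≡⟨ ⊛-congʳ g firstRecurrence n ⟩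
    (g ⊛ mono 1ℚ 0) n                        ≡⟨ ⊛-mono g 1ℚ 0 n z≤n ⟩
    1ℚ ℚ.* g n                               ≡⟨ ℚP.*-identityˡ (g n) ⟩
    g n                                      ∎

  A⊛denominator : ∀ n → (A ⊛ denominator) n ≡ C n
  A⊛denominator n = begin
    (A ⊛ denominator) n                             ≡⟨ ⊛-denominator A n ⟩
    (A ⊛ mono r ℓ) n ℚ.+ mulOneMinus c (A ⊛ C) n    ≡⟨ cong (ℚ._+ _) (trans (⊛-comm T C n) (secondRecurrence n)) ⟨
    (T ⊛ C) n ℚ.+ mulOneMinus c (A ⊛ C) n           ≡⟨ T⊛+A⊛-cancel C n ⟩
    C n                                             ∎

  T⊛denominator : ∀ n → (T ⊛ denominator) n ≡ mono r ℓ n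
  T⊛denominator n = begin
    (T ⊛ denominator) n                                     ≡⟨ ⊛-denominator T n ⟩
    (T ⊛ mono r ℓ) n ℚ.+ mulOneMinus c (T ⊛ C) n            ≡⟨ cong ((T ⊛ mono r ℓ) n ℚ.+_) (mulOneMinus-cong c T⊛C≗A⊛mono n) ⟩
    (T ⊛ mono r ℓ) n ℚ.+ mulOneMinus c (A ⊛ mono r ℓ) n     ≡⟨ T⊛+A⊛-cancel (mono r ℓ) n ⟩
    mono r ℓ n                                              ∎
    where
      T⊛C≗A⊛mono : ∀ j → (T ⊛ C) j ≡ (A ⊛ mono r ℓ) j
      T⊛C≗A⊛mono j = trans (⊛-comm T C j) (secondRecurrence j)

  module Normalised (ρ : ℚ) (ρr≡1 : ρ ℚ.* r ≡ 1ℚ) (C* : Series) (C*≗ρC : ∀ j → C* j ≡ ρ ℚ.* C j) where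

    denominator* : Series
    denominator* = mono 1ℚ ℓ ⊕ ((mono 1ℚ 0 ⊖ mono c 1) ⊛ C*)

    denominator*≗ρdenominator : ∀ j → denominator* j ≡ ρ ℚ.* denominator j
    denominator*≗ρdenominator j = begin
      mono 1ℚ ℓ j ℚ.+ ((mono 1ℚ 0 ⊖ mono c 1) ⊛ C*) j
        ≡⟨ cong₂ ℚ._+_ (trans (cong (λ x → mono x ℓ j) (sym ρr≡1)) (sym (*-mono ρ r ℓ j)))
                       (trans (⊛-congʳ (mono 1ℚ 0 ⊖ mono c 1) C*≗ρC j) (⊛-scaleʳ ρ (mono 1ℚ 0 ⊖ mono c 1) C j)) ⟩
      ρ ℚ.* mono r ℓ j ℚ.+ ρ ℚ.* ((mono 1ℚ 0 ⊖ mono c 1) ⊛ C) j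
        ≡⟨ ℚP.*-distribˡ-+ ρ _ _ ⟨
      ρ ℚ.* denominator j ∎

    ⊛-denominator* : ∀ f n → (f ⊛ denominator*) n ≡ ρ ℚ.* (f ⊛ denominator) n
    ⊛-denominator* f n = trans (⊛-congʳ f denominator*≗ρdenominator n) (⊛-scaleʳ ρ f denominator n)

    A⊛denominator* : ∀ n → (A ⊛ denominator*) n ≡ C* n
    A⊛denominator* n = trans (⊛-denominator* A n) (trans (cong (ρ ℚ.*_) (A⊛denominator n)) (sym (C*≗ρC n)))

    T⊛denominator* : ∀ n → (T ⊛ denominator*) n ≡ mono 1ℚ ℓ n
    T⊛denominator* n = begin
      (T ⊛ denominator*) n     ≡⟨ ⊛-denominator* T n ⟩
      ρ ℚ.* (T ⊛ denominator) n ≡⟨ cong (ρ ℚ.*_) (T⊛denominator n) ⟩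
      ρ ℚ.* mono r ℓ n         ≡⟨ *-mono ρ r ℓ n ⟩
      mono (ρ ℚ.* r) ℓ n       ≡⟨ cong (λ x → mono x ℓ n) ρr≡1 ⟩
      mono 1ℚ ℓ n              ∎

-- Permutation groups acting on words

module _ {q : ℕ} where

  lookup-∘ₚ : ∀ (σ τ : Perm q) i → lookup (σ ∘ₚ τ) i ≡ lookup σ (lookup τ i)
  lookup-∘ₚ σ τ = VP.lookup∘tabulate (λ j → lookup σ (lookup τ j))

  lookup-idPerm : ∀ i → lookup (idPerm {q}) i ≡ i
  lookup-idPerm = VP.lookup∘tabulate (λ j → j)

  perm-ext : ∀ {σ τ : Perm q} → (∀ i → lookup σ i ≡ lookup τ i) → σ ≡ τ
  perm-ext {σ} {τ} σ≗τ = trans (sym (VP.tabulate∘lookup σ)) (trans (VP.tabulate-cong σ≗τ) (VP.tabulate∘lookup τ))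

  ∘ₚ-assoc : ∀ (σ τ υ : Perm q) → (σ ∘ₚ τ) ∘ₚ υ ≡ σ ∘ₚ (τ ∘ₚ υ)
  ∘ₚ-assoc σ τ υ = perm-ext λ i → begin
    lookup ((σ ∘ₚ τ) ∘ₚ υ) i           ≡⟨ lookup-∘ₚ (σ ∘ₚ τ) υ i ⟩
    lookup (σ ∘ₚ τ) (lookup υ i)       ≡⟨ lookup-∘ₚ σ τ (lookup υ i) ⟩
    lookup σ (lookup τ (lookup υ i))   ≡⟨ cong (lookup σ) (lookup-∘ₚ τ υ i) ⟨
    lookup σ (lookup (τ ∘ₚ υ) i)       ≡⟨ lookup-∘ₚ σ (τ ∘ₚ υ) i ⟨
    lookup (σ ∘ₚ (τ ∘ₚ υ)) i           ∎
    where open ≡-Reasoning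

  ∘ₚ-identityˡ : ∀ (σ : Perm q) → idPerm ∘ₚ σ ≡ σ
  ∘ₚ-identityˡ σ = perm-ext λ i → trans (lookup-∘ₚ idPerm σ i) (lookup-idPerm (lookup σ i))

  ∘ₚ-identityʳ : ∀ (σ : Perm q) → σ ∘ₚ idPerm ≡ σ
  ∘ₚ-identityʳ σ = perm-ext λ i → trans (lookup-∘ₚ σ idPerm i) (cong (lookup σ) (lookup-idPerm i))

  act-∘ₚ : ∀ (σ τ : Perm q) w → act (σ ∘ₚ τ) w ≡ act σ (act τ w)
  act-∘ₚ σ τ w = trans (LP.map-cong (lookup-∘ₚ σ τ) w) (LP.map-∘ w)

  act-idPerm : ∀ (w : Word q) → act idPerm w ≡ w
  act-idPerm w = trans (LP.map-cong lookup-idPerm w) (LP.map-id w)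

  length-act : ∀ (σ : Perm q) w → length (act σ w) ≡ length w
  length-act σ = LP.length-map (lookup σ)

  ==w-true : ∀ {u v : Word q} → u ≡ v → (u ==w v) ≡ true
  ==w-true {u} {v} u≡v with LP.≡-dec F._≟_ u v
  ... | yes _   = refl
  ... | no u≢v = ⊥-elim (u≢v u≡v)

  ==w-false : ∀ {u v : Word q} → u ≢ v → (u ==w v) ≡ false
  ==w-false {u} {v} u≢v with LP.≡-dec F._≟_ u v
  ... | yes u≡v = ⊥-elim (u≢v u≡v)
  ... | no _    = refl

  ==w-sound : ∀ {u v : Word q} → T (u ==w v) → u ≡ v
  ==w-sound = toWitness

  ==w-sym : ∀ (u v : Word q) → (u ==w v) ≡ (v ==w u)
  ==w-sym u v with LP.≡-dec F._≟_ u v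
  ... | yes u≡v = sym (==w-true (sym u≡v))
  ... | no  u≢v = sym (==w-false (u≢v ∘ sym))

module InGroup {q : ℕ} (G : PermGroup q) where

  private
    E : List (Perm q)
    E = elems G

  inverse : ∀ {σ} → σ ∈ E → ∃ λ τ → τ ∈ E × σ ∘ₚ τ ≡ idPerm × τ ∘ₚ σ ≡ idPerm
  inverse {σ} σ∈ with inverses G σ σ∈
  ... | τ , τ∈ , στ≡id = τ , τ∈ , στ≡id , perm-ext τσ≗id
    where
      στ≗id : ∀ j → lookup σ (lookup τ j) ≡ j
      στ≗id j = trans (sym (lookup-∘ₚ σ τ j)) (trans (cong (λ υ → lookup υ j) στ≡id) (lookup-idPerm j))
      τσ≗id : ∀ i → lookup (τ ∘ₚ σ) i ≡ lookup idPerm i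
      τσ≗id i = trans (lookup-∘ₚ τ σ i) (trans (perms G σ σ∈ _ _ (στ≗id (lookup σ i))) (sym (lookup-idPerm i)))

  act-injective : ∀ {σ} → σ ∈ E → ∀ {u v} → act σ u ≡ act σ v → u ≡ v
  act-injective σ∈ = LP.map-injective (λ {i} {j} → perms G _ σ∈ i j)

  act-inverse : ∀ {σ} → σ ∈ E → ∃ λ τ → τ ∈ E × (∀ w → act τ (act σ w) ≡ w)
  act-inverse {σ} σ∈ with inverse σ∈
  ... | τ , τ∈ , _ , τσ≡id = τ , τ∈ , λ w →
    trans (sym (act-∘ₚ τ σ w)) (trans (cong (λ υ → act υ w) τσ≡id) (act-idPerm w))

  ==w-act : ∀ {σ} → σ ∈ E → ∀ (u v : Word q) → (act σ u ==w act σ v) ≡ (u ==w v)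
  ==w-act {σ} σ∈ u v with LP.≡-dec F._≟_ u v
  ... | yes u≡v = ==w-true (cong (act σ) u≡v)
  ... | no  u≢v = ==w-false (u≢v ∘ act-injective σ∈)

  equiv-sound : ∀ {u v} → T (equiv G u v) → ∃ λ σ → σ ∈ E × act σ u ≡ v
  equiv-sound {u} {v} u∼v with find (any⁻ (λ σ → act σ u ==w v) E u∼v)
  ... | σ , σ∈ , σu≡v = σ , σ∈ , ==w-sound σu≡v

  equiv-complete : ∀ {σ u v} → σ ∈ E → act σ u ≡ v → T (equiv G u v)
  equiv-complete {σ} {u} {v} σ∈ σu≡v =
    any⁺ (λ σ → act σ u ==w v) (lose σ∈ (subst T (sym (==w-true σu≡v)) tt))

  ∘ₚ-cancelˡ : ∀ {τ} → τ ∈ E → ∀ {σ₁ σ₂} → τ ∘ₚ σ₁ ≡ τ ∘ₚ σ₂ → σ₁ ≡ σ₂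
  ∘ₚ-cancelˡ {τ} τ∈ {σ₁} {σ₂} eq = perm-ext λ i → perms G τ τ∈ _ _
    (trans (sym (lookup-∘ₚ τ σ₁ i)) (trans (cong (λ υ → lookup υ i) eq) (lookup-∘ₚ τ σ₂ i)))

  ∘ₚ-cancelʳ : ∀ {τ} → τ ∈ E → ∀ {σ₁ σ₂} → σ₁ ∘ₚ τ ≡ σ₂ ∘ₚ τ → σ₁ ≡ σ₂
  ∘ₚ-cancelʳ {τ} τ∈ {σ₁} {σ₂} eq with inverse τ∈
  ... | τ′ , _ , ττ′≡id , _ = begin
    σ₁                    ≡⟨ ∘ₚ-identityʳ σ₁ ⟨
    σ₁ ∘ₚ idPerm          ≡⟨ cong (σ₁ ∘ₚ_) ττ′≡id ⟨
    σ₁ ∘ₚ (τ ∘ₚ τ′)       ≡⟨ ∘ₚ-assoc σ₁ τ τ′ ⟨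
    (σ₁ ∘ₚ τ) ∘ₚ τ′       ≡⟨ cong (_∘ₚ τ′) eq ⟩
    (σ₂ ∘ₚ τ) ∘ₚ τ′       ≡⟨ ∘ₚ-assoc σ₂ τ τ′ ⟩
    σ₂ ∘ₚ (τ ∘ₚ τ′)       ≡⟨ cong (σ₂ ∘ₚ_) ττ′≡id ⟩
    σ₂ ∘ₚ idPerm          ≡⟨ ∘ₚ-identityʳ σ₂ ⟩
    σ₂                    ∎
    where open ≡-Reasoning

  map-bijection-↭ : (g : Perm q → Perm q) → (∀ {σ₁ σ₂} → g σ₁ ≡ g σ₂ → σ₁ ≡ σ₂) →
                    (∀ {σ} → σ ∈ E → g σ ∈ E) → (∀ {σ} → σ ∈ E → ∃ λ σ′ → σ′ ∈ E × g σ′ ≡ σ) →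
                    map g E ↭ E
  map-bijection-↭ g g-injective g-into g-onto =
    ∼bag⇒↭ (unique∧set⇒bag (Unique.map⁺ g-injective (unique G)) (unique G) (mk⇔ into onto))
    where
      into : ∀ {σ} → σ ∈ map g E → σ ∈ E
      into σ∈ with ∈-map⁻ g σ∈
      ... | σ′ , σ′∈ , refl = g-into σ′∈
      onto : ∀ {σ} → σ ∈ E → σ ∈ map g E
      onto σ∈ with g-onto σ∈
      ... | σ′ , σ′∈ , refl = ∈-map⁺ g σ′∈

  ∑-translateˡ : ∀ {τ} → τ ∈ E → (h : Perm q → ℕ) → ℕΣ.∑ (λ σ → h (τ ∘ₚ σ)) E ≡ ℕΣ.∑ h E
  ∑-translateˡ {τ} τ∈ h = trans (sym (ℕΣ.∑-map h (τ ∘ₚ_) E))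
    (ℕΣ.∑-↭ h (map-bijection-↭ (τ ∘ₚ_) (∘ₚ-cancelˡ τ∈) (closed G τ _ τ∈) onto))
    where
      onto : ∀ {σ} → σ ∈ E → ∃ λ σ′ → σ′ ∈ E × τ ∘ₚ σ′ ≡ σ
      onto {σ} σ∈ with inverse τ∈
      ... | τ′ , τ′∈ , ττ′≡id , _ = τ′ ∘ₚ σ , closed G τ′ σ τ′∈ σ∈ ,
        trans (sym (∘ₚ-assoc τ τ′ σ)) (trans (cong (_∘ₚ σ) ττ′≡id) (∘ₚ-identityˡ σ))

  ∑-translateʳ : ∀ {τ} → τ ∈ E → (h : Perm q → ℕ) → ℕΣ.∑ (λ σ → h (σ ∘ₚ τ)) E ≡ ℕΣ.∑ h E
  ∑-translateʳ {τ} τ∈ h = trans (sym (ℕΣ.∑-map h (_∘ₚ τ) E))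
    (ℕΣ.∑-↭ h (map-bijection-↭ (_∘ₚ τ) (∘ₚ-cancelʳ τ∈) (λ σ∈ → closed G _ τ σ∈ τ∈) onto))
    where
      onto : ∀ {σ} → σ ∈ E → ∃ λ σ′ → σ′ ∈ E × σ′ ∘ₚ τ ≡ σ
      onto {σ} σ∈ with inverse τ∈
      ... | τ′ , τ′∈ , _ , τ′τ≡id = σ ∘ₚ τ′ , closed G σ τ′ σ∈ τ′∈ ,
        trans (∘ₚ-assoc σ τ′ τ) (trans (cong (σ ∘ₚ_) τ′τ≡id) (∘ₚ-identityʳ σ))

  fibreSize : ∀ x pre → ℕΣ.∑ (λ σ → 𝟙 (x ==w act σ pre)) E ≡ (if equiv G x pre then stabSize G x else 0)
  fibreSize x pre with equiv G x pre in x∼pre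
  ... | true with equiv-sound (subst T (sym x∼pre) tt)
  ...   | σ₁ , σ₁∈ , σ₁x≡pre with act-inverse σ₁∈
  ...     | τ , τ∈ , τσ₁≗id = begin
    ℕΣ.∑ (λ σ → 𝟙 (x ==w act σ pre)) E               ≡⟨ ∑-translateʳ τ∈ (λ σ → 𝟙 (x ==w act σ pre)) ⟨
    ℕΣ.∑ (λ σ → 𝟙 (x ==w act (σ ∘ₚ τ) pre)) E        ≡⟨ ℕΣ.∑-cong (λ σ → cong (λ w → 𝟙 (x ==w w)) (trans (act-∘ₚ σ τ pre) (cong (act σ) τpre≡x))) E ⟩
    ℕΣ.∑ (λ σ → 𝟙 (x ==w act σ x)) E                 ≡⟨ ℕΣ.∑-cong (λ σ → cong 𝟙 (==w-sym x (act σ x))) E ⟩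
    ℕΣ.∑ (λ σ → 𝟙 (act σ x ==w x)) E                 ≡⟨ length-filter-∑ (λ σ → LP.≡-dec F._≟_ (act σ x) x) E ⟨
    stabSize G x                                     ∎
    where
      open ≡-Reasoning
      τpre≡x : act τ pre ≡ x
      τpre≡x = trans (cong (act τ) (sym σ₁x≡pre)) (τσ₁≗id x)
  fibreSize x pre | false = ℕΣ.∑-zero-∈ E none
    where
      none : ∀ {σ} → σ ∈ E → 𝟙 (x ==w act σ pre) ≡ 0
      none {σ} σ∈ with x ==w act σ pre in x≡σpre
      ... | false = refl
      ... | true with act-inverse σ∈
      ...   | τ , τ∈ , τσ≗id = ⊥-elim (subst T x∼pre (equiv-complete τ∈
                (trans (cong (act τ) (==w-sound (subst T (sym x≡σpre) tt))) (τσ≗id pre))))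

-- Words and occurrences

∑-indicator-point : ∀ q (x : Fin q) (g : Fin q → ℕ) → ℕΣ.∑ (λ a → 𝟙 ⌊ a F.≟ x ⌋ * g a) (allFin q) ≡ g x
∑-indicator-point (suc q) x g = begin
  ℕΣ.∑ h (allFin (suc q))                            ≡⟨ cong (λ as → h F.zero + ℕΣ.∑ h as) (sym (LP.map-tabulate id F.suc)) ⟩
  h F.zero + ℕΣ.∑ h (map F.suc (allFin q))           ≡⟨ cong (h F.zero +_) (ℕΣ.∑-map h F.suc (allFin q)) ⟩
  h F.zero + ℕΣ.∑ (h ∘ F.suc) (allFin q)             ≡⟨ split x ⟩
  g x                                                ∎
  where
    open ≡-Reasoning
    h : Fin (suc q) → ℕ
    h a = 𝟙 ⌊ a F.≟ x ⌋ * g a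
    split : ∀ x → 𝟙 ⌊ F.zero F.≟ x ⌋ * g F.zero + ℕΣ.∑ (λ a → 𝟙 ⌊ F.suc a F.≟ x ⌋ * g (F.suc a)) (allFin q) ≡ g x
    split F.zero     = trans (cong₂ _+_ (ℕP.+-identityʳ (g F.zero)) (ℕΣ.∑-zero-∈ (allFin q) (λ _ → refl))) (ℕP.+-identityʳ _)
    split (F.suc x′) = trans (ℕΣ.∑-cong suc-≟-suc (allFin q)) (∑-indicator-point q x′ (g ∘ F.suc))
      where
        suc-≟-suc : ∀ a → 𝟙 ⌊ F.suc a F.≟ F.suc x′ ⌋ * g (F.suc a) ≡ 𝟙 ⌊ a F.≟ x′ ⌋ * g (F.suc a)
        suc-≟-suc a with a F.≟ x′
        ... | yes _ = refl
        ... | no  _ = refl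

∷-==w-∷ : ∀ {q} (a x : Fin q) (w c : Word q) → ((a ∷ w) ==w (x ∷ c)) ≡ ⌊ a F.≟ x ⌋ ∧ (w ==w c)
∷-==w-∷ a x w c = ⌊∷-dec⌋ (a F.≟ x) (LP.≡-dec F._≟_ w c)
  where
    -- Decidable equality of lists is map′ over ×-dec; it computes once both decisions do.
    ⌊∷-dec⌋ : ∀ (a≟x : Dec (a ≡ x)) (w≟c : Dec (w ≡ c)) →
              ⌊ map′ (uncurry (cong₂ _∷_)) LP.∷-injective (a≟x ×-dec w≟c) ⌋ ≡ ⌊ a≟x ⌋ ∧ ⌊ w≟c ⌋
    ⌊∷-dec⌋ (yes _) (yes _) = refl
    ⌊∷-dec⌋ (yes _) (no _)  = refl
    ⌊∷-dec⌋ (no _)  _       = refl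

module _ {A : Set} where

  take-length-++ : ∀ (u v : List A) k → take (length u + k) (u ++ v) ≡ u ++ take k v
  take-length-++ []      v k = refl
  take-length-++ (x ∷ u) v k = cong (x ∷_) (take-length-++ u v k)

  take-++-≡ : ∀ n (u v : List A) → length u ≡ n → take n (u ++ v) ≡ u
  take-++-≡ n u v refl = trans (cong (λ k → take k (u ++ v)) (sym (ℕP.+-identityʳ (length u))))
                               (trans (take-length-++ u v 0) (LP.++-identityʳ u))

  drop-++-≡ : ∀ n (u v : List A) → length u ≡ n → drop n (u ++ v) ≡ v
  drop-++-≡ _ []      v refl = refl
  drop-++-≡ _ (x ∷ u) v refl = drop-++-≡ _ u v refl

  length-take-≤ : ∀ n (y : List A) → n ≤ length y → length (take n y) ≡ n
  length-take-≤ n y n≤∣y∣ = trans (LP.length-take n y) (ℕP.m≤n⇒m⊓n≡m n≤∣y∣)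

  take-drop-take : ∀ j k m (y : List A) → j + k ≤ m → take k (drop j (take m y)) ≡ take k (drop j y)
  take-drop-take zero    k m       y       j+k≤m       = trans (LP.take-take k m y) (cong (λ i → take i y) (ℕP.m≤n⇒m⊓n≡m j+k≤m))
  take-drop-take (suc j) k (suc m) []      _           = refl
  take-drop-take (suc j) k (suc m) (x ∷ y) (s≤s j+k≤m) = take-drop-take j k m y j+k≤m

module AllWords (q : ℕ) where

  open ℕΣ using (∑)

  W : ℕ → List (Word q)
  W = allWords q

  ∑-W-suc : ∀ n (f : Word q → ℕ) → ∑ f (W (suc n)) ≡ ∑ (λ w → ∑ (λ a → f (a ∷ w)) (allFin q)) (W n)
  ∑-W-suc n f = trans (ℕΣ.∑-concatMap f (λ w → map (_∷ w) (allFin q)) (W n))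
                      (ℕΣ.∑-cong (λ w → ℕΣ.∑-map f (_∷ w) (allFin q)) (W n))

  ∑-W-cong : ∀ n {f g : Word q → ℕ} → (∀ w → length w ≡ n → f w ≡ g w) → ∑ f (W n) ≡ ∑ g (W n)
  ∑-W-cong zero    f≗g = cong (_+ 0) (f≗g [] refl)
  ∑-W-cong (suc n) {f} {g} f≗g = begin
    ∑ f (W (suc n))                                      ≡⟨ ∑-W-suc n f ⟩
    ∑ (λ w → ∑ (λ a → f (a ∷ w)) (allFin q)) (W n)       ≡⟨ ∑-W-cong n (λ w ∣w∣≡n → ℕΣ.∑-cong (λ a → f≗g (a ∷ w) (cong suc ∣w∣≡n)) (allFin q)) ⟩
    ∑ (λ w → ∑ (λ a → g (a ∷ w)) (allFin q)) (W n)       ≡⟨ ∑-W-suc n g ⟨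
    ∑ g (W (suc n))                                      ∎
    where open ≡-Reasoning

  ∑-W-+ : ∀ m n (f : Word q → ℕ) → ∑ f (W (m + n)) ≡ ∑ (λ u → ∑ (λ t → f (u ++ t)) (W n)) (W m)
  ∑-W-+ zero    n f = sym (ℕP.+-identityʳ _)
  ∑-W-+ (suc m) n f = begin
    ∑ f (W (suc m + n))                                                  ≡⟨ ∑-W-suc (m + n) f ⟩
    ∑ (λ y → ∑ (λ a → f (a ∷ y)) (allFin q)) (W (m + n))                 ≡⟨ ∑-W-+ m n _ ⟩
    ∑ (λ u → ∑ (λ t → ∑ (λ a → f (a ∷ u ++ t)) (allFin q)) (W n)) (W m)  ≡⟨ ℕΣ.∑-cong (λ u → ℕΣ.∑-swap (λ t a → f (a ∷ u ++ t)) (W n) (allFin q)) (W m) ⟩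
    ∑ (λ u → ∑ (λ a → ∑ (λ t → f (a ∷ u ++ t)) (W n)) (allFin q)) (W m)  ≡⟨ ∑-W-suc m (λ u → ∑ (λ t → f (u ++ t)) (W n)) ⟨
    ∑ (λ u → ∑ (λ t → f (u ++ t)) (W n)) (W (suc m))                     ∎
    where open ≡-Reasoning

  ∑-W-one : ∀ (c : ℕ) → ∑ (λ _ → c) (W 1) ≡ q * c
  ∑-W-one c = trans (∑-W-suc 0 (λ _ → c)) (trans (ℕP.+-identityʳ _)
    (trans (∑-const c (allFin q)) (cong (_* c) (LP.length-tabulate {n = q} id))))

  ∑-W-point : ∀ n (c : Word q) → length c ≡ n → (h : Word q → ℕ) → ∑ (λ t → 𝟙 (t ==w c) * h t) (W n) ≡ h c
  ∑-W-point zero    []      refl h = trans (ℕP.+-identityʳ (h [] + 0)) (ℕP.+-identityʳ (h []))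
  ∑-W-point (suc n) (x ∷ c) ∣c∣≡n h = begin
    ∑ (λ t → 𝟙 (t ==w (x ∷ c)) * h t) (W (suc n))
      ≡⟨ ∑-W-suc n _ ⟩
    ∑ (λ w → ∑ (λ a → 𝟙 ((a ∷ w) ==w (x ∷ c)) * h (a ∷ w)) (allFin q)) (W n)
      ≡⟨ ℕΣ.∑-cong (λ w → trans (ℕΣ.∑-cong (factor w) (allFin q)) (∑-indicator-point q x (λ a → 𝟙 (w ==w c) * h (a ∷ w)))) (W n) ⟩
    ∑ (λ w → 𝟙 (w ==w c) * h (x ∷ w)) (W n)
      ≡⟨ ∑-W-point n c (ℕP.suc-injective ∣c∣≡n) (h ∘ (x ∷_)) ⟩
    h (x ∷ c) ∎
    where
      open ≡-Reasoning
      factor : ∀ w a → 𝟙 ((a ∷ w) ==w (x ∷ c)) * h (a ∷ w) ≡ 𝟙 ⌊ a F.≟ x ⌋ * (𝟙 (w ==w c) * h (a ∷ w))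
      factor w a = trans (cong (λ b → 𝟙 b * h (a ∷ w)) (∷-==w-∷ a x w c))
        (trans (cong (_* h (a ∷ w)) (𝟙-∧ ⌊ a F.≟ x ⌋ (w ==w c))) (ℕP.*-assoc (𝟙 ⌊ a F.≟ x ⌋) _ _))

  ∑-fibres : ∀ {B : Set} n k (φ : B → Word q) → (∀ b → length (φ b) ≡ k) → (bs : List B) (f : Word q → ℕ) →
             ∑ (λ b → ∑ (λ w → f (w ++ φ b)) (W n)) bs
               ≡ ∑ (λ u → f u * ∑ (λ b → 𝟙 (drop n u ==w φ b)) bs) (W (n + k))
  ∑-fibres n k φ ∣φ∣≡k bs f = begin
    ∑ (λ b → ∑ (λ w → f (w ++ φ b)) (W n)) bs
      ≡⟨ ℕΣ.∑-swap (λ b w → f (w ++ φ b)) bs (W n) ⟩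
    ∑ (λ w → ∑ (λ b → f (w ++ φ b)) bs) (W n)
      ≡⟨ ℕΣ.∑-cong (λ w → ℕΣ.∑-cong (λ b → ∑-W-point k (φ b) (∣φ∣≡k b) (λ s → f (w ++ s))) bs) (W n) ⟨
    ∑ (λ w → ∑ (λ b → ∑ (λ s → 𝟙 (s ==w φ b) * f (w ++ s)) (W k)) bs) (W n)
      ≡⟨ ℕΣ.∑-cong (λ w → ℕΣ.∑-swap (λ b s → 𝟙 (s ==w φ b) * f (w ++ s)) bs (W k)) (W n) ⟩
    ∑ (λ w → ∑ (λ s → ∑ (λ b → 𝟙 (s ==w φ b) * f (w ++ s)) bs) (W k)) (W n)
      ≡⟨ ℕΣ.∑-cong (λ w → ℕΣ.∑-cong (λ s → factor-out (f (w ++ s)) s) (W k)) (W n) ⟩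
    ∑ (λ w → ∑ (λ s → f (w ++ s) * fibre s) (W k)) (W n)
      ≡⟨ ∑-W-cong n (λ w ∣w∣≡n → ℕΣ.∑-cong (λ s → cong (λ t → f (w ++ s) * fibre t) (sym (drop-++-≡ n w s ∣w∣≡n))) (W k)) ⟩
    ∑ (λ w → ∑ (λ s → f (w ++ s) * fibre (drop n (w ++ s))) (W k)) (W n)
      ≡⟨ ∑-W-+ n k (λ u → f u * fibre (drop n u)) ⟨
    ∑ (λ u → f u * fibre (drop n u)) (W (n + k)) ∎
    where
      open ≡-Reasoning
      fibre : Word q → ℕ
      fibre s = ∑ (λ b → 𝟙 (s ==w φ b)) bs
      factor-out : ∀ x s → ∑ (λ b → 𝟙 (s ==w φ b) * x) bs ≡ x * fibre s
      factor-out x s = trans (ℕΣ.∑-cong (λ b → ℕP.*-comm (𝟙 (s ==w φ b)) x) bs) (ℕΣ.∑-*ˡ x (λ b → 𝟙 (s ==w φ b)) bs)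

any-++ : ∀ {A : Set} (f : A → Bool) xs ys → any f (xs ++ ys) ≡ any f xs ∨ any f ys
any-++ f []       ys = refl
any-++ f (x ∷ xs) ys = trans (cong (f x ∨_) (any-++ f xs ys)) (sym (BoolP.∨-assoc (f x) _ _))

not-∨ : ∀ a b → not (a ∨ b) ≡ not a ∧ not b
not-∨ true  b = refl
not-∨ false b = refl

𝟙-split : ∀ a b → 𝟙 (b ∧ a) + 𝟙 (a ∧ not b) ≡ 𝟙 a
𝟙-split true  true  = refl
𝟙-split true  false = refl
𝟙-split false true  = refl
𝟙-split false false = refl

<∸⇒+< : ∀ j m k → j < m ∸ k → j + k < m
<∸⇒+< j m       zero    j<m   = subst (_< m) (sym (ℕP.+-identityʳ j)) j<m
<∸⇒+< j (suc m) (suc k) j<m∸k = subst (_< suc m) (sym (ℕP.+-suc j k)) (s≤s (<∸⇒+< j m k j<m∸k))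

∸≤⇒≤+ : ∀ m k j → m ∸ k ≤ j → m ≤ j + k
∸≤⇒≤+ m k j m∸k≤j = ℕP.≤-trans (ℕP.m≤n+m∸n m k) (ℕP.≤-trans (ℕP.+-monoʳ-≤ k m∸k≤j) (ℕP.≤-reflexive (ℕP.+-comm k j)))

module Occurrences {q : ℕ} (G : PermGroup q) (p : Word q) where

  ℓ : ℕ
  ℓ = length p

  occ : Word q → ℕ → Bool
  occ = occAt G p

  noOccBefore : Word q → ℕ → Bool
  noOccBefore y c = not (any (occ y) (upTo c))

  firstOccAt : Word q → ℕ → Bool
  firstOccAt y k = occ y k ∧ noOccBefore y k

  noOccBefore-suc : ∀ y c → noOccBefore y (suc c) ≡ noOccBefore y c ∧ not (occ y c)
  noOccBefore-suc y c = begin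
    not (any (occ y) (upTo (suc c)))                  ≡⟨ cong (not ∘ any (occ y)) (sym (LP.upTo-∷ʳ c)) ⟩
    not (any (occ y) (upTo c ++ c ∷ []))              ≡⟨ cong not (any-++ (occ y) (upTo c) (c ∷ [])) ⟩
    not (any (occ y) (upTo c) ∨ (occ y c ∨ false))    ≡⟨ cong (λ b → not (any (occ y) (upTo c) ∨ b)) (BoolP.∨-identityʳ (occ y c)) ⟩
    not (any (occ y) (upTo c) ∨ occ y c)              ≡⟨ not-∨ (any (occ y) (upTo c)) (occ y c) ⟩
    noOccBefore y c ∧ not (occ y c)                   ∎
    where open ≡-Reasoning

  noOccBefore-cong : ∀ x y c → (∀ j → j < c → occ x j ≡ occ y j) → noOccBefore x c ≡ noOccBefore y c
  noOccBefore-cong x y zero    _    = refl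
  noOccBefore-cong x y (suc c) x≗y = begin
    noOccBefore x (suc c)               ≡⟨ noOccBefore-suc x c ⟩
    noOccBefore x c ∧ not (occ x c)     ≡⟨ cong₂ (λ a b → a ∧ not b) (noOccBefore-cong x y c (λ j j<c → x≗y j (ℕP.m<n⇒m<1+n j<c))) (x≗y c ℕP.≤-refl) ⟩
    noOccBefore y c ∧ not (occ y c)     ≡⟨ noOccBefore-suc y c ⟨
    noOccBefore y (suc c)               ∎
    where open ≡-Reasoning

  noOccBefore-stable : ∀ y c d → c ≤ d → (∀ j → c ≤ j → j < d → occ y j ≡ false) →
                       noOccBefore y d ≡ noOccBefore y c
  noOccBefore-stable y c zero    z≤n   _ = refl
  noOccBefore-stable y c (suc d) c≤1+d none with ℕP.m≤n⇒m<n∨m≡n c≤1+d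
  ... | inj₂ refl      = refl
  ... | inj₁ (s≤s c≤d) = begin
    noOccBefore y (suc d)                ≡⟨ noOccBefore-suc y d ⟩
    noOccBefore y d ∧ not (occ y d)      ≡⟨ cong₂ (λ a b → a ∧ not b) (noOccBefore-stable y c d c≤d (λ j c≤j j<d → none j c≤j (ℕP.m<n⇒m<1+n j<d))) (none d c≤d ℕP.≤-refl) ⟩
    noOccBefore y c ∧ true               ≡⟨ BoolP.∧-identityʳ _ ⟩
    noOccBefore y c                      ∎
    where open ≡-Reasoning

  occAt-beyond : ∀ y j → length y < j + ℓ → occ y j ≡ false
  occAt-beyond y j ∣y∣<j+ℓ rewrite ≤ᵇ-false ∣y∣<j+ℓ = refl

  occAt-take : ∀ y j m → j + ℓ ≤ m → m ≤ length y → occ (take m y) j ≡ occ y j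
  occAt-take y j m j+ℓ≤m m≤∣y∣
    rewrite length-take-≤ m y m≤∣y∣ | ≤ᵇ-true j+ℓ≤m | ≤ᵇ-true (ℕP.≤-trans j+ℓ≤m m≤∣y∣)
          | take-drop-take j ℓ m y j+ℓ≤m = refl

  avoids≡noOccBefore : ∀ w → avoids G p w ≡ noOccBefore w (suc (length w) ∸ ℓ)
  avoids≡noOccBefore w = noOccBefore-stable w (suc (length w) ∸ ℓ) (suc (length w)) (ℕP.m∸n≤m _ ℓ)
    (λ j c≤j _ → occAt-beyond w j (∸≤⇒≤+ (suc (length w)) ℓ j c≤j))

  avoids-take : ∀ n y → n ≤ length y → avoids G p (take n y) ≡ noOccBefore y (suc n ∸ ℓ)
  avoids-take n y n≤∣y∣ = begin
    avoids G p (take n y)                               ≡⟨ avoids≡noOccBefore (take n y) ⟩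
    noOccBefore (take n y) (suc (length (take n y)) ∸ ℓ) ≡⟨ cong (λ m → noOccBefore (take n y) (suc m ∸ ℓ)) (length-take-≤ n y n≤∣y∣) ⟩
    noOccBefore (take n y) (suc n ∸ ℓ)                  ≡⟨ noOccBefore-cong (take n y) y (suc n ∸ ℓ) (λ j j<c → occAt-take y j n (ℕP.≤-pred (<∸⇒+< j (suc n) ℓ j<c)) n≤∣y∣) ⟩
    noOccBefore y (suc n ∸ ℓ)                           ∎
    where open ≡-Reasoning

  avoids+onlyAtEnd : ∀ n y → length y ≡ suc n →
                     𝟙 (avoids G p y) + 𝟙 (onlyAtEnd G p y) ≡ 𝟙 (avoids G p (take n y))
  avoids+onlyAtEnd n y ∣y∣≡1+n with ℓ ℕP.≤? suc n
  ... | yes ℓ≤1+n = begin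
    𝟙 (avoids G p y) + 𝟙 (onlyAtEnd G p y)               ≡⟨ cong₂ _+_ (cong 𝟙 avoids-y) (cong 𝟙 onlyAtEnd-y) ⟩
    𝟙 (noOccBefore y c ∧ not (occ y c)) + 𝟙 (true ∧ firstOccAt y c)  ≡⟨ ℕP.+-comm (𝟙 (noOccBefore y c ∧ not (occ y c))) _ ⟩
    𝟙 (occ y c ∧ noOccBefore y c) + 𝟙 (noOccBefore y c ∧ not (occ y c)) ≡⟨ 𝟙-split (noOccBefore y c) (occ y c) ⟩
    𝟙 (noOccBefore y c)                                  ≡⟨ cong 𝟙 (avoids-take n y n≤∣y∣) ⟨
    𝟙 (avoids G p (take n y))                            ∎
    where
      open ≡-Reasoning
      c : ℕ
      c = suc n ∸ ℓ
      n≤∣y∣ : n ≤ length y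
      n≤∣y∣ = subst (n ≤_) (sym ∣y∣≡1+n) (ℕP.n≤1+n n)
      avoids-y : avoids G p y ≡ noOccBefore y c ∧ not (occ y c)
      avoids-y = trans (avoids≡noOccBefore y) (trans (cong (λ m → noOccBefore y (suc m ∸ ℓ)) ∣y∣≡1+n)
                   (trans (cong (noOccBefore y) (ℕP.+-∸-assoc 1 ℓ≤1+n)) (noOccBefore-suc y c)))
      onlyAtEnd-y : onlyAtEnd G p y ≡ true ∧ firstOccAt y c
      onlyAtEnd-y rewrite ∣y∣≡1+n | ≤ᵇ-true ℓ≤1+n = refl
  ... | no ℓ≰1+n = begin
    𝟙 (avoids G p y) + 𝟙 (onlyAtEnd G p y)     ≡⟨ cong₂ _+_ (cong 𝟙 avoids-y) (cong 𝟙 onlyAtEnd-y) ⟩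
    1                                          ≡⟨ cong 𝟙 avoids-prefix ⟨
    𝟙 (avoids G p (take n y))                  ∎
    where
      open ≡-Reasoning
      1+n<ℓ : suc n < ℓ
      1+n<ℓ = ℕP.≰⇒> ℓ≰1+n
      avoids-y : avoids G p y ≡ true
      avoids-y = trans (avoids≡noOccBefore y) (trans (cong (λ m → noOccBefore y (suc m ∸ ℓ)) ∣y∣≡1+n)
                   (cong (noOccBefore y) (ℕP.m≤n⇒m∸n≡0 1+n<ℓ)))
      onlyAtEnd-y : onlyAtEnd G p y ≡ false
      onlyAtEnd-y rewrite ∣y∣≡1+n | ≤ᵇ-false 1+n<ℓ = refl
      avoids-prefix : avoids G p (take n y) ≡ true
      avoids-prefix = trans (avoids-take n y (subst (n ≤_) (sym ∣y∣≡1+n) (ℕP.n≤1+n n)))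
                        (cong (noOccBefore y) (ℕP.m≤n⇒m∸n≡0 (ℕP.<⇒≤ 1+n<ℓ)))

  onlyAtEnd-take : ∀ y k → k + ℓ ≤ length y → onlyAtEnd G p (take (k + ℓ) y) ≡ firstOccAt y k
  onlyAtEnd-take y k k+ℓ≤∣y∣ = begin
    (ℓ ≤ᵇ length x) ∧ firstOccAt x (length x ∸ ℓ)   ≡⟨ cong (λ m → (ℓ ≤ᵇ m) ∧ firstOccAt x (m ∸ ℓ)) (length-take-≤ (k + ℓ) y k+ℓ≤∣y∣) ⟩
    (ℓ ≤ᵇ k + ℓ) ∧ firstOccAt x (k + ℓ ∸ ℓ)         ≡⟨ cong₂ (λ b m → b ∧ firstOccAt x m) (≤ᵇ-true (ℕP.m≤n+m ℓ k)) (ℕP.m+n∸n≡m k ℓ) ⟩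
    firstOccAt x k                                 ≡⟨ cong₂ _∧_ (occAt-take y k (k + ℓ) ℕP.≤-refl k+ℓ≤∣y∣)
                                                          (noOccBefore-cong x y k (λ j j<k → occAt-take y j (k + ℓ) (ℕP.+-monoˡ-≤ ℓ (ℕP.<⇒≤ j<k)) k+ℓ≤∣y∣)) ⟩
    firstOccAt y k                                 ∎
    where
      open ≡-Reasoning
      x : Word q
      x = take (k + ℓ) y

  noOccBefore-telescope : ∀ n y → occ y n ≡ true → ∀ d → d ≤ suc n →
                          𝟙 (noOccBefore y (suc n ∸ d)) ≡ ℕΣ.∑< (λ i → 𝟙 (firstOccAt y (n ∸ i))) d
  noOccBefore-telescope n y occ-n zero _ =
    cong 𝟙 (trans (noOccBefore-suc y n) (trans (cong (λ b → noOccBefore y n ∧ not b) occ-n) (BoolP.∧-zeroʳ _)))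
  noOccBefore-telescope n y occ-n (suc d) (s≤s d≤n) = begin
    𝟙 (noOccBefore y k)                                          ≡⟨ 𝟙-split (noOccBefore y k) (occ y k) ⟨
    𝟙 (firstOccAt y k) + 𝟙 (noOccBefore y k ∧ not (occ y k))     ≡⟨ cong (λ b → 𝟙 (firstOccAt y k) + 𝟙 b) (noOccBefore-suc y k) ⟨
    𝟙 (firstOccAt y k) + 𝟙 (noOccBefore y (suc k))               ≡⟨ cong (λ m → 𝟙 (firstOccAt y k) + 𝟙 (noOccBefore y m)) (ℕP.+-∸-assoc 1 d≤n) ⟨
    𝟙 (firstOccAt y k) + 𝟙 (noOccBefore y (suc n ∸ d))           ≡⟨ cong (𝟙 (firstOccAt y k) +_) (noOccBefore-telescope n y occ-n d (ℕP.m≤n⇒m≤1+n d≤n)) ⟩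
    𝟙 (firstOccAt y k) + ℕΣ.∑< f d                               ≡⟨ ℕP.+-comm (𝟙 (firstOccAt y k)) _ ⟩
    ℕΣ.∑< f d + f d                                              ≡⟨ ℕΣ.∑<-suc f d ⟨
    ℕΣ.∑< f (suc d)                                              ∎
    where
      open ≡-Reasoning
      k : ℕ
      k = n ∸ d
      f : ℕ → ℕ
      f i = 𝟙 (firstOccAt y (n ∸ i))

  module _ (0<ℓ : 0 < ℓ) (n : ℕ) (y : Word q) (∣y∣≡n+ℓ : length y ≡ n + ℓ) where

    private
      n≤∣y∣ : n ≤ length y
      n≤∣y∣ = subst (n ≤_) (sym ∣y∣≡n+ℓ) (ℕP.m≤m+n n ℓ)
      prefixOnlyAtEnd : ℕ → ℕ
      prefixOnlyAtEnd i = 𝟙 (onlyAtEnd G p (take (n + ℓ ∸ i) y))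
      prefixOnlyAtEnd-early : ∀ i → i ≤ n → prefixOnlyAtEnd i ≡ 𝟙 (firstOccAt y (n ∸ i))
      prefixOnlyAtEnd-early i i≤n = cong 𝟙 (trans (cong (λ m → onlyAtEnd G p (take m y)) n+ℓ∸i≡) (onlyAtEnd-take y (n ∸ i) fits))
        where
          n+ℓ∸i≡ : n + ℓ ∸ i ≡ (n ∸ i) + ℓ
          n+ℓ∸i≡ = trans (cong (_∸ i) (ℕP.+-comm n ℓ)) (trans (ℕP.+-∸-assoc ℓ i≤n) (ℕP.+-comm ℓ (n ∸ i)))
          fits : (n ∸ i) + ℓ ≤ length y
          fits = subst ((n ∸ i) + ℓ ≤_) (sym ∣y∣≡n+ℓ) (ℕP.+-monoˡ-≤ ℓ (ℕP.m∸n≤m n i))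
      prefixOnlyAtEnd-late : ∀ i → n < i → prefixOnlyAtEnd i ≡ 0
      prefixOnlyAtEnd-late i n<i = cong (λ b → 𝟙 (b ∧ firstOccAt x (length x ∸ ℓ))) (≤ᵇ-false short)
        where
          x : Word q
          x = take (n + ℓ ∸ i) y
          short : length x < ℓ
          short = ℕP.≤-<-trans (ℕP.≤-trans (ℕP.≤-reflexive (LP.length-take (n + ℓ ∸ i) y)) (ℕP.m⊓n≤m _ _))
                    (ℕP.m<n+o⇒m∸n<o (n + ℓ) i {{ℕ.>-nonZero 0<ℓ}} (ℕP.+-monoˡ-< ℓ n<i))

    avoids-take≡∑onlyAtEnd : occ y n ≡ true →
      𝟙 (avoids G p (take n y)) ≡ ℕΣ.∑< (λ i → 𝟙 (onlyAtEnd G p (take (n + ℓ ∸ i) y))) ℓ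
    avoids-take≡∑onlyAtEnd occ-n with ℓ ℕP.≤? suc n
    ... | yes ℓ≤1+n = begin
      𝟙 (avoids G p (take n y))                   ≡⟨ cong 𝟙 (avoids-take n y n≤∣y∣) ⟩
      𝟙 (noOccBefore y (suc n ∸ ℓ))               ≡⟨ noOccBefore-telescope n y occ-n ℓ ℓ≤1+n ⟩
      ℕΣ.∑< (λ i → 𝟙 (firstOccAt y (n ∸ i))) ℓ     ≡⟨ ℕΣ.∑<-cong ℓ (λ i i<ℓ → prefixOnlyAtEnd-early i (ℕP.≤-pred (ℕP.<-≤-trans i<ℓ ℓ≤1+n))) ⟨
      ℕΣ.∑< prefixOnlyAtEnd ℓ                                  ∎
      where open ≡-Reasoning
    ... | no ℓ≰1+n = begin
      𝟙 (avoids G p (take n y))                   ≡⟨ cong 𝟙 (avoids-take n y n≤∣y∣) ⟩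
      𝟙 (noOccBefore y (suc n ∸ ℓ))               ≡⟨ cong (λ m → 𝟙 (noOccBefore y m)) (trans (ℕP.m≤n⇒m∸n≡0 (ℕP.<⇒≤ 1+n<ℓ)) (sym (ℕP.n∸n≡0 (suc n)))) ⟩
      𝟙 (noOccBefore y (suc n ∸ suc n))           ≡⟨ noOccBefore-telescope n y occ-n (suc n) ℕP.≤-refl ⟩
      ℕΣ.∑< (λ i → 𝟙 (firstOccAt y (n ∸ i))) (suc n) ≡⟨ ℕΣ.∑<-cong (suc n) (λ i i<1+n → prefixOnlyAtEnd-early i (ℕP.≤-pred i<1+n)) ⟨
      ℕΣ.∑< prefixOnlyAtEnd (suc n)                            ≡⟨ ℕP.+-identityʳ _ ⟨
      ℕΣ.∑< prefixOnlyAtEnd (suc n) + 0                        ≡⟨ cong (ℕΣ.∑< prefixOnlyAtEnd (suc n) +_) (ℕΣ.∑<-zero (ℓ ∸ suc n) (λ j _ → prefixOnlyAtEnd-late (suc n + j) (ℕP.m≤m+n (suc n) j))) ⟨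
      ℕΣ.∑< prefixOnlyAtEnd (suc n) + ℕΣ.∑< (λ j → prefixOnlyAtEnd (suc n + j)) (ℓ ∸ suc n) ≡⟨ ℕΣ.∑<-+ prefixOnlyAtEnd (suc n) (ℓ ∸ suc n) ⟨
      ℕΣ.∑< prefixOnlyAtEnd (suc n + (ℓ ∸ suc n))              ≡⟨ cong (ℕΣ.∑< prefixOnlyAtEnd) (ℕP.m+[n∸m]≡n (ℕP.<⇒≤ 1+n<ℓ)) ⟩
      ℕΣ.∑< prefixOnlyAtEnd ℓ                                  ∎
      where
        open ≡-Reasoning
        1+n<ℓ : suc n < ℓ
        1+n<ℓ = ℕP.≰⇒> ℓ≰1+n

  onlyAtEnd⇒length≥ : ∀ u → T (onlyAtEnd G p u) → ℓ ≤ length u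
  onlyAtEnd⇒length≥ u t = ℕP.≤ᵇ⇒≤ ℓ (length u) (proj₁ (Equivalence.to T-∧ t))

  onlyAtEnd⇒suffix∼p : ∀ u → T (onlyAtEnd G p u) → T (equiv G (take ℓ (drop (length u ∸ ℓ) u)) p)
  onlyAtEnd⇒suffix∼p u t = proj₂ (Equivalence.to (T-∧ {(length u ∸ ℓ) + ℓ ≤ᵇ length u})
    (proj₁ (Equivalence.to (T-∧ {occ u (length u ∸ ℓ)}) (proj₂ (Equivalence.to (T-∧ {ℓ ≤ᵇ length u}) t)))))

-- The two recurrences

module Recurrences {q : ℕ} (G : PermGroup q) (p : Word q) (0<ℓ : 0 < length p) where

  open Occurrences G p
  open AllWords q
  open InGroup G
  open ℕΣ using (∑; ∑<)

  E : List (Perm q)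
  E = elems G

  countA≡∑ : ∀ n → countA G p n ≡ ∑ (𝟙 ∘ avoids G p) (W n)
  countA≡∑ n = trans (length-filter-∑ (λ w → T? (avoids G p w)) (W n)) (ℕΣ.∑-cong (λ w → cong 𝟙 (⌊T?⌋ (avoids G p w))) (W n))

  countT≡∑ : ∀ n → countT G p n ≡ ∑ (𝟙 ∘ onlyAtEnd G p) (W n)
  countT≡∑ n = trans (length-filter-∑ (λ w → T? (onlyAtEnd G p w)) (W n)) (ℕΣ.∑-cong (λ w → cong 𝟙 (⌊T?⌋ (onlyAtEnd G p w))) (W n))

  countA-zero : countA G p 0 ≡ 1
  countA-zero = trans (countA≡∑ 0) (cong (λ b → 𝟙 b + 0) (trans (avoids≡noOccBefore []) (cong (noOccBefore []) (ℕP.m≤n⇒m∸n≡0 0<ℓ))))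

  countT-< : ∀ n → n < ℓ → countT G p n ≡ 0
  countT-< n n<ℓ = trans (countT≡∑ n) (trans (∑-W-cong n {g = λ _ → 0} none) (ℕΣ.∑-zero-∈ (W n) (λ _ → refl)))
    where
      none : ∀ w → length w ≡ n → 𝟙 (onlyAtEnd G p w) ≡ 0
      none w refl = cong (λ b → 𝟙 (b ∧ firstOccAt w (length w ∸ ℓ))) (≤ᵇ-false n<ℓ)

  countA+countT : ∀ n → countA G p (suc n) + countT G p (suc n) ≡ q * countA G p n
  countA+countT n = begin
    countA G p (suc n) + countT G p (suc n)
      ≡⟨ cong₂ _+_ (countA≡∑ (suc n)) (countT≡∑ (suc n)) ⟩
    ∑ (𝟙 ∘ avoids G p) (W (suc n)) + ∑ (𝟙 ∘ onlyAtEnd G p) (W (suc n))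
      ≡⟨ ℕΣ.∑-distrib-+ (𝟙 ∘ avoids G p) (𝟙 ∘ onlyAtEnd G p) (W (suc n)) ⟨
    ∑ (λ y → 𝟙 (avoids G p y) + 𝟙 (onlyAtEnd G p y)) (W (suc n))
      ≡⟨ ∑-W-cong (suc n) (avoids+onlyAtEnd n) ⟩
    ∑ (λ y → 𝟙 (avoids G p (take n y))) (W (suc n))
      ≡⟨ cong (λ m → ∑ (λ y → 𝟙 (avoids G p (take n y))) (W m)) (ℕP.+-comm 1 n) ⟩
    ∑ (λ y → 𝟙 (avoids G p (take n y))) (W (n + 1))
      ≡⟨ ∑-W-+ n 1 (λ y → 𝟙 (avoids G p (take n y))) ⟩
    ∑ (λ u → ∑ (λ a → 𝟙 (avoids G p (take n (u ++ a)))) (W 1)) (W n)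
      ≡⟨ ∑-W-cong n (λ u ∣u∣≡n → trans (ℕΣ.∑-cong (λ a → cong (𝟙 ∘ avoids G p) (take-++-≡ n u a ∣u∣≡n)) (W 1)) (∑-W-one _)) ⟩
    ∑ (λ u → q * 𝟙 (avoids G p u)) (W n)
      ≡⟨ ℕΣ.∑-*ˡ q (𝟙 ∘ avoids G p) (W n) ⟩
    q * ∑ (𝟙 ∘ avoids G p) (W n)
      ≡⟨ cong (q *_) (countA≡∑ n) ⟨
    q * countA G p n ∎
    where open ≡-Reasoning

  autoCoeffℕ : ℕ → ℕ
  autoCoeffℕ i = if equiv G (drop i p) (take (ℓ ∸ i) p) then stabSize G (drop i p) else 0

  fibre-onlyAtEnd : ∀ n i u → i < ℓ → length u ≡ n + (ℓ ∸ i) → T (onlyAtEnd G p u) →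
                    ∑ (λ σ → 𝟙 (drop n u ==w act σ (take (ℓ ∸ i) p))) E ≡ autoCoeffℕ i
  fibre-onlyAtEnd n i u i<ℓ ∣u∣≡n+k onlyAtEnd-u with equiv-sound (onlyAtEnd⇒suffix∼p u onlyAtEnd-u)
  ... | τ , τ∈ , τb≡p = begin
    ∑ (λ σ → 𝟙 (drop n u ==w act σ pre)) E                 ≡⟨ cong (λ x → ∑ (λ σ → 𝟙 (x ==w act σ pre)) E) drop-i-b≡drop-n-u ⟨
    ∑ (λ σ → 𝟙 (drop i b ==w act σ pre)) E                 ≡⟨ ℕΣ.∑-cong (λ σ → cong 𝟙 (trans (sym (==w-act τ∈ (drop i b) (act σ pre))) (cong₂ _==w_ τ-drop (sym (act-∘ₚ τ σ pre))))) E ⟩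
    ∑ (λ σ → 𝟙 (drop i p ==w act (τ ∘ₚ σ) pre)) E          ≡⟨ ∑-translateˡ τ∈ (λ σ → 𝟙 (drop i p ==w act σ pre)) ⟩
    ∑ (λ σ → 𝟙 (drop i p ==w act σ pre)) E                 ≡⟨ fibreSize (drop i p) pre ⟩
    autoCoeffℕ i                                              ∎
    where
      open ≡-Reasoning
      k : ℕ
      k = ℓ ∸ i
      pre : Word q
      pre = take k p
      j : ℕ
      j = length u ∸ ℓ
      b : Word q
      b = take ℓ (drop j u)
      τ-drop : act τ (drop i b) ≡ drop i p
      τ-drop = trans (sym (LP.drop-map i b)) (cong (drop i) τb≡p)
      ℓ≤∣u∣ : ℓ ≤ length u
      ℓ≤∣u∣ = onlyAtEnd⇒length≥ u onlyAtEnd-u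
      j+i≡n : j + i ≡ n
      j+i≡n = ℕP.+-cancelʳ-≡ k (j + i) n (begin
        j + i + k       ≡⟨ ℕP.+-assoc j i k ⟩
        j + (i + k)     ≡⟨ cong (j +_) (ℕP.m+[n∸m]≡n (ℕP.<⇒≤ i<ℓ)) ⟩
        j + ℓ           ≡⟨ ℕP.m∸n+n≡m ℓ≤∣u∣ ⟩
        length u        ≡⟨ ∣u∣≡n+k ⟩
        n + k           ∎)
      ∣drop-n-u∣≡k : length (drop n u) ≡ k
      ∣drop-n-u∣≡k = trans (LP.length-drop n u) (trans (cong (_∸ n) ∣u∣≡n+k) (ℕP.m+n∸m≡n n k))
      drop-i-b≡drop-n-u : drop i b ≡ drop n u
      drop-i-b≡drop-n-u = begin
        drop i (take ℓ (drop j u))        ≡⟨ cong (λ m → drop i (take m (drop j u))) (ℕP.m+[n∸m]≡n (ℕP.<⇒≤ i<ℓ)) ⟨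
        drop i (take (i + k) (drop j u))  ≡⟨ LP.take-drop k i (drop j u) ⟨
        take k (drop i (drop j u))        ≡⟨ cong (take k) (LP.drop-drop j i u) ⟩
        take k (drop (j + i) u)           ≡⟨ cong (λ m → take k (drop m u)) j+i≡n ⟩
        take k (drop n u)                 ≡⟨ LP.take-all k (drop n u) (ℕP.≤-reflexive ∣drop-n-u∣≡k) ⟩
        drop n u                          ∎

  occAt-++-act : ∀ n {σ} → σ ∈ E → ∀ w → length w ≡ n → occ (w ++ act σ p) n ≡ true
  occAt-++-act n {σ} σ∈ w ∣w∣≡n with act-inverse σ∈
  ... | τ , τ∈ , τσ≗id = cong₂ _∧_ (≤ᵇ-true (ℕP.≤-reflexive (sym ∣w++σp∣≡n+ℓ)))
        (Equivalence.to T-≡ (subst (λ x → T (equiv G x p)) (sym suffix≡σp) (equiv-complete τ∈ (τσ≗id p))))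
    where
      ∣w++σp∣≡n+ℓ : length (w ++ act σ p) ≡ n + ℓ
      ∣w++σp∣≡n+ℓ = trans (LP.length-++ w) (cong₂ _+_ ∣w∣≡n (length-act σ p))
      suffix≡σp : take ℓ (drop n (w ++ act σ p)) ≡ act σ p
      suffix≡σp = trans (cong (take ℓ) (drop-++-≡ n w (act σ p) ∣w∣≡n)) (LP.take-all ℓ (act σ p) (ℕP.≤-reflexive (length-act σ p)))

  ∑-prefix-onlyAtEnd : ∀ n i → i < ℓ →
    ∑ (λ σ → ∑ (λ w → 𝟙 (onlyAtEnd G p (take (n + ℓ ∸ i) (w ++ act σ p)))) (W n)) E ≡ autoCoeffℕ i * countT G p (n + (ℓ ∸ i))
  ∑-prefix-onlyAtEnd n i i<ℓ = begin
    ∑ (λ σ → ∑ (λ w → 𝟙 (onlyAtEnd G p (take (n + ℓ ∸ i) (w ++ act σ p)))) (W n)) E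
      ≡⟨ ℕΣ.∑-cong (λ σ → ∑-W-cong n (λ w ∣w∣≡n → cong (𝟙 ∘ onlyAtEnd G p) (truncate σ w ∣w∣≡n))) E ⟩
    ∑ (λ σ → ∑ (λ w → 𝟙 (onlyAtEnd G p (w ++ act σ pre))) (W n)) E
      ≡⟨ ∑-fibres n k (λ σ → act σ pre) ∣σpre∣≡k E (𝟙 ∘ onlyAtEnd G p) ⟩
    ∑ (λ u → 𝟙 (onlyAtEnd G p u) * ∑ (λ σ → 𝟙 (drop n u ==w act σ pre)) E) (W (n + k))
      ≡⟨ ∑-W-cong (n + k) fibre ⟩
    ∑ (λ u → autoCoeffℕ i * 𝟙 (onlyAtEnd G p u)) (W (n + k))
      ≡⟨ ℕΣ.∑-*ˡ (autoCoeffℕ i) (𝟙 ∘ onlyAtEnd G p) (W (n + k)) ⟩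
    autoCoeffℕ i * ∑ (𝟙 ∘ onlyAtEnd G p) (W (n + k))
      ≡⟨ cong (autoCoeffℕ i *_) (countT≡∑ (n + k)) ⟨
    autoCoeffℕ i * countT G p (n + k) ∎
    where
      open ≡-Reasoning
      k : ℕ
      k = ℓ ∸ i
      pre : Word q
      pre = take k p
      ∣σpre∣≡k : ∀ σ → length (act σ pre) ≡ k
      ∣σpre∣≡k σ = trans (length-act σ pre) (length-take-≤ k p (ℕP.m∸n≤m ℓ i))
      truncate : ∀ σ w → length w ≡ n → take (n + ℓ ∸ i) (w ++ act σ p) ≡ w ++ act σ pre
      truncate σ w ∣w∣≡n = begin
        take (n + ℓ ∸ i) (w ++ act σ p)       ≡⟨ cong (λ m → take m (w ++ act σ p)) (trans (ℕP.+-∸-assoc n (ℕP.<⇒≤ i<ℓ)) (cong (_+ k) (sym ∣w∣≡n))) ⟩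
        take (length w + k) (w ++ act σ p)    ≡⟨ take-length-++ w (act σ p) k ⟩
        w ++ take k (act σ p)                 ≡⟨ cong (w ++_) (LP.take-map k p) ⟩
        w ++ act σ pre                        ∎
      fibre : ∀ u → length u ≡ n + k → 𝟙 (onlyAtEnd G p u) * ∑ (λ σ → 𝟙 (drop n u ==w act σ pre)) E ≡ autoCoeffℕ i * 𝟙 (onlyAtEnd G p u)
      fibre u ∣u∣≡n+k with onlyAtEnd G p u in onlyAtEnd-u
      ... | true  = trans (ℕP.+-identityʳ _) (trans (fibre-onlyAtEnd n i u i<ℓ ∣u∣≡n+k (subst T (sym onlyAtEnd-u) tt)) (sym (ℕP.*-identityʳ _)))
      ... | false = sym (ℕP.*-zeroʳ (autoCoeffℕ i))

  |G|*countA : ∀ n → length E * countA G p n ≡ ∑< (λ i → autoCoeffℕ i * countT G p (n + (ℓ ∸ i))) ℓ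
  |G|*countA n = begin
    length E * countA G p n
      ≡⟨ ∑-const (countA G p n) E ⟨
    ∑ (λ σ → countA G p n) E
      ≡⟨ ℕΣ.∑-cong-∈ E (λ σ∈ → trans (countA≡∑ n) (∑-W-cong n (decompose σ∈))) ⟩
    ∑ (λ σ → ∑ (λ w → ∑< (cut σ w) ℓ) (W n)) E
      ≡⟨ ℕΣ.∑-cong (λ σ → ℕΣ.∑-swap (cut σ) (W n) (upTo ℓ)) E ⟩
    ∑ (λ σ → ∑< (λ i → ∑ (λ w → cut σ w i) (W n)) ℓ) E
      ≡⟨ ℕΣ.∑-swap (λ σ i → ∑ (λ w → cut σ w i) (W n)) E (upTo ℓ) ⟩
    ∑< (λ i → ∑ (λ σ → ∑ (λ w → cut σ w i) (W n)) E) ℓ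
      ≡⟨ ℕΣ.∑<-cong ℓ (∑-prefix-onlyAtEnd n) ⟩
    ∑< (λ i → autoCoeffℕ i * countT G p (n + (ℓ ∸ i))) ℓ ∎
    where
      open ≡-Reasoning
      cut : Perm q → Word q → ℕ → ℕ
      cut σ w i = 𝟙 (onlyAtEnd G p (take (n + ℓ ∸ i) (w ++ act σ p)))
      decompose : ∀ {σ} → σ ∈ E → ∀ w → length w ≡ n → 𝟙 (avoids G p w) ≡ ∑< (cut σ w) ℓ
      decompose {σ} σ∈ w ∣w∣≡n = trans (cong (𝟙 ∘ avoids G p) (sym (take-++-≡ n w (act σ p) ∣w∣≡n)))
        (avoids-take≡∑onlyAtEnd 0<ℓ n (w ++ act σ p) (trans (LP.length-++ w) (cong₂ _+_ ∣w∣≡n (length-act σ p))) (occAt-++-act n σ∈ w ∣w∣≡n))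

-- The generating functions

module Coefficients {q : ℕ} (G : PermGroup q) (p : Word q) (0<ℓ : 0 < length p) where

  open Occurrences G p using (ℓ)
  open Recurrences G p 0<ℓ
  open InGroup G
  open ≡-Reasoning

  𝒜 𝒯 𝒞 : Series
  𝒜 = genA G p
  𝒯 = genT G p
  𝒞 = autoPoly G p

  c r 1/|Gp| : ℚ
  c = toℚ q
  r = orbitSize G p
  1/|Gp| = divℚ 1ℚ (stabSize G p)

  autoPoly-< : ∀ i → i < ℓ → 𝒞 i ≡ toℚ (autoCoeffℕ i) ℚ.* 1/|Gp|
  autoPoly-< i i<ℓ rewrite ≤ᵇ-true i<ℓ with equiv G (drop i p) (take (ℓ ∸ i) p)
  ... | true  = divℚ-≡-*-divℚ1 (toℚ (stabSize G (drop i p))) (stabSize G p)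
  ... | false = sym (ℚP.*-zeroˡ 1/|Gp|)

  autoPoly-≥ : ∀ i → ℓ ≤ i → 𝒞 i ≡ 0ℚ
  autoPoly-≥ i ℓ≤i rewrite ≤ᵇ-false (s≤s ℓ≤i) = refl

  firstRecurrenceℚ : ∀ n → 𝒯 n ℚ.+ mulOneMinus c 𝒜 n ≡ mono 1ℚ 0 n
  firstRecurrenceℚ zero = begin
    toℚ (countT G p 0) ℚ.+ (toℚ (countA G p 0) ℚ.+ ℚ.- c ℚ.* 0ℚ)
      ≡⟨ cong₂ (λ t a → toℚ t ℚ.+ (toℚ a ℚ.+ ℚ.- c ℚ.* 0ℚ)) (countT-< 0 0<ℓ) countA-zero ⟩
    0ℚ ℚ.+ (1ℚ ℚ.+ ℚ.- c ℚ.* 0ℚ)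
      ≡⟨ solve 1 (λ c → con 0ℚ :+ (con 1ℚ :+ (:- c) :* con 0ℚ) := con 1ℚ) refl c ⟩
    1ℚ ∎
    where open +-*-Solver
  firstRecurrenceℚ (suc n) = begin
    𝒯 (suc n) ℚ.+ (𝒜 (suc n) ℚ.+ ℚ.- c ℚ.* 𝒜 n)
      ≡⟨ solve 4 (λ t a′ a c → t :+ (a′ :+ (:- c) :* a) := (a′ :+ t) :+ (:- c) :* a) refl (𝒯 (suc n)) (𝒜 (suc n)) (𝒜 n) c ⟩
    (𝒜 (suc n) ℚ.+ 𝒯 (suc n)) ℚ.+ ℚ.- c ℚ.* 𝒜 n
      ≡⟨ cong (ℚ._+ ℚ.- c ℚ.* 𝒜 n) (trans (sym (toℚ-+ (countA G p (suc n)) (countT G p (suc n)))) (trans (cong toℚ (countA+countT n)) (toℚ-* q (countA G p n)))) ⟩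
    c ℚ.* 𝒜 n ℚ.+ ℚ.- c ℚ.* 𝒜 n
      ≡⟨ solve 2 (λ c a → c :* a :+ (:- c) :* a := con 0ℚ) refl c (𝒜 n) ⟩
    0ℚ ∎
    where open +-*-Solver

  secondRecurrenceℚ-< : ∀ n → n < ℓ → (𝒞 ⊛ 𝒯) n ≡ (𝒜 ⊛ mono r ℓ) n
  secondRecurrenceℚ-< n n<ℓ = trans (ℚΣ.∑<-zero (suc n) (λ k k≤n → trans (cong (λ t → 𝒞 k ℚ.* toℚ t) (countT-< (n ∸ k) (short k))) (ℚP.*-zeroʳ (𝒞 k))))
                       (sym (⊛-mono-< 𝒜 r ℓ n n<ℓ))
    where
      short : ∀ k → n ∸ k < ℓ
      short k = ℕP.≤-<-trans (ℕP.m∸n≤m n k) n<ℓ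

  secondRecurrenceℚ-≥ : ∀ n → ℓ ≤ n → (𝒞 ⊛ 𝒯) n ≡ (𝒜 ⊛ mono r ℓ) n
  secondRecurrenceℚ-≥ n ℓ≤n = begin
    (𝒞 ⊛ 𝒯) n                                 ≡⟨ ⊛-truncateˡ 𝒞 𝒯 ℓ n autoPoly-≥ ℓ≤n ⟩
    ℚΣ.∑< (λ i → 𝒞 i ℚ.* 𝒯 (n ∸ i)) ℓ         ≡⟨ ℚΣ.∑<-cong ℓ term ⟩
    ℚΣ.∑< (λ i → 1/|Gp| ℚ.* toℚ (w i)) ℓ       ≡⟨ ℚΣ.∑-*ˡ 1/|Gp| (toℚ ∘ w) (L.upTo ℓ) ⟩
    1/|Gp| ℚ.* ℚΣ.∑< (toℚ ∘ w) ℓ               ≡⟨ cong (1/|Gp| ℚ.*_) (toℚ-∑ w (L.upTo ℓ)) ⟨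
    1/|Gp| ℚ.* toℚ (ℕΣ.∑< w ℓ)                 ≡⟨ cong (λ x → 1/|Gp| ℚ.* toℚ x) (|G|*countA m) ⟨
    1/|Gp| ℚ.* toℚ (|G| * countA G p m)        ≡⟨ cong (1/|Gp| ℚ.*_) (toℚ-* |G| (countA G p m)) ⟩
    1/|Gp| ℚ.* (toℚ |G| ℚ.* 𝒜 m)               ≡⟨ solve 3 (λ u g a → u :* (g :* a) := (g :* u) :* a) refl 1/|Gp| (toℚ |G|) (𝒜 m) ⟩
    (toℚ |G| ℚ.* 1/|Gp|) ℚ.* 𝒜 m               ≡⟨ cong (ℚ._* 𝒜 m) (divℚ-≡-*-divℚ1 (toℚ |G|) (stabSize G p)) ⟨
    r ℚ.* 𝒜 (n ∸ ℓ)                            ≡⟨ ⊛-mono 𝒜 r ℓ n ℓ≤n ⟨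
    (𝒜 ⊛ mono r ℓ) n                           ∎
    where
      open +-*-Solver
      m |G| : ℕ
      m = n ∸ ℓ
      |G| = length (elems G)
      w : ℕ → ℕ
      w i = autoCoeffℕ i * countT G p (m + (ℓ ∸ i))
      term : ∀ i → i < ℓ → 𝒞 i ℚ.* 𝒯 (n ∸ i) ≡ 1/|Gp| ℚ.* toℚ (w i)
      term i i<ℓ = begin
        𝒞 i ℚ.* 𝒯 (n ∸ i)                                             ≡⟨ cong₂ ℚ._*_ (autoPoly-< i i<ℓ) (cong (toℚ ∘ countT G p) n∸i≡) ⟩
        (toℚ (autoCoeffℕ i) ℚ.* 1/|Gp|) ℚ.* toℚ (countT G p (m + k))   ≡⟨ solve 3 (λ a u t → (a :* u) :* t := u :* (a :* t)) refl (toℚ (autoCoeffℕ i)) 1/|Gp| (toℚ (countT G p (m + k))) ⟩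
        1/|Gp| ℚ.* (toℚ (autoCoeffℕ i) ℚ.* toℚ (countT G p (m + k)))   ≡⟨ cong (1/|Gp| ℚ.*_) (toℚ-* (autoCoeffℕ i) (countT G p (m + k))) ⟨
        1/|Gp| ℚ.* toℚ (w i)                                          ∎
        where
          k : ℕ
          k = ℓ ∸ i
          n∸i≡ : n ∸ i ≡ m + k
          n∸i≡ = trans (cong (_∸ i) (sym (ℕP.m∸n+n≡m ℓ≤n))) (ℕP.+-∸-assoc m (ℕP.<⇒≤ i<ℓ))

  secondRecurrenceℚ : ∀ n → (𝒞 ⊛ 𝒯) n ≡ (𝒜 ⊛ mono r ℓ) n
  secondRecurrenceℚ n = [ secondRecurrenceℚ-≥ n , secondRecurrenceℚ-< n ]′ (ℕP.≤-<-connex ℓ n)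

  1≤|G| : 1 ≤ length (elems G)
  1≤|G| with elems G | hasId G
  ... | _ ∷ _ | _ = s≤s z≤n

  1≤|Gp| : 1 ≤ stabSize G p
  1≤|Gp| = subst (1 ≤_) (sym (length-filter-∑ (λ σ → LP.≡-dec F._≟_ (act σ p) p) (elems G)))
    (ℕP.≤-trans (ℕP.≤-reflexive (cong 𝟙 (sym (==w-true (act-idPerm p)))))
                (∈⇒≤∑ (λ σ → 𝟙 (act σ p ==w p)) (hasId G)))

  orbitSize≢0 : r ≢ 0ℚ
  orbitSize≢0 with length (elems G) | 1≤|G| | stabSize G p | 1≤|Gp|
  ... | suc g | _ | suc s | _ = divℚ-suc-≢0 g s

  open FromRecurrences 𝒜 𝒯 𝒞 c r ℓ firstRecurrenceℚ secondRecurrenceℚ public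
  open Normalised (divByℚ 1ℚ r) (trans (ℚP.*-comm _ r) (*-divByℚ1-inverse r orbitSize≢0)) (autoPoly* G p)
                  (λ j → trans (divByℚ-≡-*-divByℚ1 (𝒞 j) r) (ℚP.*-comm (𝒞 j) _)) public

-- The identities hold for every word p and every q.
mainTheorem2 : (q : ℕ) → 2 ≤ q → (G : PermGroup q) → (p : Word q) →
    IsPattern G p → 1 ≤ length p →
    ((∀ n → (genA G p ⊛ denom* G p) n ≡ autoPoly* G p n)
      × (∀ n → (genA G p ⊛ denom G p) n ≡ autoPoly G p n))
    × ((∀ n → (genT G p ⊛ denom* G p) n ≡ mono 1ℚ (length p) n)
      × (∀ n → (genT G p ⊛ denom G p) n ≡ mono (orbitSize G p) (length p) n))
mainTheorem2 q _ G p _ 1≤ℓ = (A⊛denominator* , A⊛denominator) , (T⊛denominator* , T⊛denominator)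
  where open Coefficients G p 1≤ℓ
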